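{- Let $m \ge 4$ be even and $1 \le a \le b < \frac m2$. If at least one of the following conditions fails, then $B_1(m;a,b)$ is not a nut graph: (i) $m \equiv 2 \pmod 4$; (ii) $a$ and $b$ are both even; (iii) $\gcd(\frac m2,a,b)=1$; (iv) if $5\mid m$, then at least one of $a,b,a-b,a+b$ is divisible by $5$.
   Context: A graph is a nut graph if $0$ is an adjacency eigenvalue of multiplicity one and a corresponding eigenvector has no zero entries. $B_1(m;a,b)$ is the graph on vertices $x_0,\dots,x_{m-1},y_0,\dots,y_{m-1}$ (indices mod $m$) with edges $x_ix_{i\pm a}$, $x_ix_{i+m/2}$, $y_iy_{i\pm b}$, $y_iy_{i+m/2}$ and $x_iy_i$ for all $i$. -}

module Defs where

open import Data.Nat using (ℕ; zero; suc; _+_; NonZero; _≡ᵇ_)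
open import Data.Nat.DivMod using (_%_; _/_)
open import Data.Bool using (Bool; true; false; _∨_)
open import Data.Fin using (Fin; toℕ; splitAt)
import Data.Fin as F
open import Data.Sum using (_⊎_; inj₁; inj₂)
open import Data.Product using (Σ; ∃; _×_; _,_)
open import Data.Rational using (ℚ; 0ℚ; 1ℚ; _*_) renaming (_+_ to _+ℚ_)
open import Relation.Binary.PropositionalEquality using (_≡_)
open import Relation.Nullary using (¬_)

Graph : ℕ → Set
Graph n = Fin n → Fin n → Bool

Σ[<_]_ : (n : ℕ) → (Fin n → ℚ) → ℚ
Σ[< zero ] f = 0ℚ
Σ[< suc n ] f = f F.zero +ℚ (Σ[< n ] (λ i → f (F.suc i)))


adjEntry : Bool → ℚ
adjEntry true  = 1ℚ
adjEntry false = 0ℚ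

InKernel : {n : ℕ} → Graph n → (Fin n → ℚ) → Set
InKernel {n} G x = ∀ u → (Σ[< n ] (λ v → adjEntry (G u v) * x v)) ≡ 0ℚ

-- Nut graph: 0 is an eigenvalue of A(G) of multiplicity one (A(G) is
-- symmetric, so this means its kernel is one-dimensional), and a
-- corresponding eigenvector (spanning the kernel) has no zero entries.
IsNut : {n : ℕ} → Graph n → Set
IsNut {n} G =
  Σ (Fin n → ℚ) λ x →
    InKernel G x
    × (∀ v → ¬ (x v ≡ 0ℚ))
    × (∀ y → InKernel G y → ∃ λ (c : ℚ) → ∀ v → y v ≡ c * x v)

-- The graph B₁(m; a, b) on Fin (m + m): vertex k < m is x_k,
-- vertex m + k is y_k.
cycAdj : (m : ℕ) {{_ : NonZero m}} → ℕ → ℕ → ℕ → Bool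
cycAdj m s i j =
  (((i + s) % m) ≡ᵇ j) ∨ ((((j + s) % m) ≡ᵇ i) ∨ (((i + (m / 2)) % m) ≡ᵇ j))

B₁ : (m a b : ℕ) {{_ : NonZero m}} → Graph (m + m)
B₁ m a b u v with splitAt m u | splitAt m v
... | inj₁ i | inj₁ j = cycAdj m a (toℕ i) (toℕ j)
... | inj₂ i | inj₂ j = cycAdj m b (toℕ i) (toℕ j)
... | inj₁ i | inj₂ j = toℕ i ≡ᵇ toℕ j
... | inj₂ i | inj₁ j = toℕ i ≡ᵇ toℕ j

{-# OPTIONS --safe #-}
-- A vector on B₁(m; a, b) is a pair of m-periodic functions X, Y : ℤ → ℚ, its values on the x- and
-- the y-vertices; with h = m / 2 it lies in the kernel iff for all i
--   X (i + a) + X (i - a) + X (i + h) + Y i = 0   and   Y (i + b) + Y (i - b) + Y (i + h) + X i = 0.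
-- The maps i ↦ k - i act as automorphisms, so in a nut graph the kernel vector satisfies
-- X (k - i) = d_k X i; k = 0 forces d₀ = 1, and then k = 1 gives X (i + 1) = c X i with c² = 1.
-- The equations at 0 become (2cᵃ + cʰ)(2cᵇ + cʰ) = 1, so a ≡ b ≢ h (mod 2), and h odd means
-- m ≡ 2 (mod 4). In each remaining case a second kernel vector vanishes at x₁ but not at x₀, which a
-- nut graph does not allow: X i = cos (π i / 2) when a and b are odd, and X i = (-1)ⁱ [d ∣ i] when
-- a and b are even, for d = gcd (h, a, b) > 1, or for d = 5 when 5 ∣ m and a, b, a ± b ≢ 0 (mod 5).
module Submission where

open import Defs
open import Data.Bool using (Bool; true; false; T; _∨_)
open import Data.Bool.Properties using (T-∨)
open import Data.Empty using (⊥; ⊥-elim)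
open import Data.Fin as Fin using (Fin; toℕ; _↑ˡ_; _↑ʳ_)
import Data.Fin.Properties as FinP
open import Data.Nat as ℕ using (ℕ; zero; suc; NonZero)
open import Data.Product using (_×_; _,_; proj₁; proj₂; ∃-syntax; uncurry)
open import Data.Sum using (_⊎_; inj₁; inj₂; [_,_]′)
open import Function using (_∘_; _⇔_; mk⇔; Equivalence)
open import Relation.Binary.PropositionalEquality
open import Relation.Nullary using (¬_; yes; no)
import Data.Integer.Solver
import Data.Rational.Solver

module ℤ-Solver = Data.Integer.Solver.+-*-Solver
module ℚ-Solver = Data.Rational.Solver.+-*-Solver

module FiniteSums where
  open import Data.Rational using (ℚ; 0ℚ; 1ℚ; _+_; _*_)
  open import Data.Rational.Properties
    using (+-identityˡ; +-identityʳ; +-assoc; *-zeroˡ; *-identityˡ)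
  open ℚ-Solver
  open ≡-Reasoning
  open Equivalence using (to; from)

  Σ-cong : ∀ n {f g : Fin n → ℚ} → (∀ i → f i ≡ g i) → Σ[< n ] f ≡ Σ[< n ] g
  Σ-cong zero    f≗g = refl
  Σ-cong (suc n) f≗g = cong₂ _+_ (f≗g Fin.zero) (Σ-cong n (f≗g ∘ Fin.suc))

  Σ-++ : ∀ m n (f : Fin (m ℕ.+ n) → ℚ) →
    Σ[< m ℕ.+ n ] f ≡ Σ[< m ] (f ∘ (_↑ˡ n)) + Σ[< n ] (f ∘ (m ↑ʳ_))
  Σ-++ zero    n f = sym (+-identityˡ _)
  Σ-++ (suc m) n f = trans (cong (f Fin.zero +_) (Σ-++ m n (f ∘ Fin.suc)))
    (sym (+-assoc (f Fin.zero) (Σ[< m ] (f ∘ Fin.suc ∘ (_↑ˡ n))) (Σ[< n ] (f ∘ Fin.suc ∘ (m ↑ʳ_)))))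

  Σ-+ : ∀ n (f g : Fin n → ℚ) → Σ[< n ] (λ i → f i + g i) ≡ Σ[< n ] f + Σ[< n ] g
  Σ-+ zero    f g = refl
  Σ-+ (suc n) f g = trans (cong (f Fin.zero + g Fin.zero +_) (Σ-+ n (f ∘ Fin.suc) (g ∘ Fin.suc)))
    (solve 4 (λ a b c d → (a :+ b) :+ (c :+ d) := (a :+ c) :+ (b :+ d)) refl
      (f Fin.zero) (g Fin.zero) (Σ[< n ] (f ∘ Fin.suc)) (Σ[< n ] (g ∘ Fin.suc)))

  adjEntry-true : ∀ {p} → T p → adjEntry p ≡ 1ℚ
  adjEntry-true {true} _ = refl

  adjEntry-false : ∀ {p} → ¬ T p → adjEntry p ≡ 0ℚ
  adjEntry-false {false} _ = refl
  adjEntry-false {true}  ¬p = ⊥-elim (¬p _)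

  adjEntry-∨ : ∀ {p q} → (T p → T q → ⊥) → adjEntry (p ∨ q) ≡ adjEntry p + adjEntry q
  adjEntry-∨ {true}  {true}  p#q = ⊥-elim (p#q _ _)
  adjEntry-∨ {true}  {false} _   = refl
  adjEntry-∨ {false} {true}  _   = refl
  adjEntry-∨ {false} {false} _   = refl

  Σ-indicator-empty : ∀ n (p : Fin n → Bool) (f : Fin n → ℚ) → (∀ j → ¬ T (p j)) →
    Σ[< n ] (λ j → adjEntry (p j) * f j) ≡ 0ℚ
  Σ-indicator-empty zero    p f none = refl
  Σ-indicator-empty (suc n) p f none = begin
    adjEntry (p Fin.zero) * f Fin.zero + Σ[< n ] (λ j → adjEntry (p (Fin.suc j)) * f (Fin.suc j))
      ≡⟨ cong₂ _+_ (cong (_* f Fin.zero) (adjEntry-false (none Fin.zero)))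
                   (Σ-indicator-empty n (p ∘ Fin.suc) (f ∘ Fin.suc) (none ∘ Fin.suc)) ⟩
    0ℚ * f Fin.zero + 0ℚ ≡⟨ cong (_+ 0ℚ) (*-zeroˡ (f Fin.zero)) ⟩
    0ℚ ∎

  Σ-indicator : ∀ n (p : Fin n → Bool) (t : Fin n) (f : Fin n → ℚ) → (∀ j → T (p j) ⇔ t ≡ j) →
    Σ[< n ] (λ j → adjEntry (p j) * f j) ≡ f t
  Σ-indicator (suc n) p Fin.zero f p≐t = begin
    adjEntry (p Fin.zero) * f Fin.zero + Σ[< n ] (λ j → adjEntry (p (Fin.suc j)) * f (Fin.suc j))
      ≡⟨ cong₂ _+_ (cong (_* f Fin.zero) (adjEntry-true (from (p≐t Fin.zero) refl)))
                   (Σ-indicator-empty n (p ∘ Fin.suc) (f ∘ Fin.suc)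
                      (λ j pj → 0≢suc (to (p≐t (Fin.suc j)) pj))) ⟩
    1ℚ * f Fin.zero + 0ℚ ≡⟨ trans (+-identityʳ (1ℚ * f Fin.zero)) (*-identityˡ (f Fin.zero)) ⟩
    f Fin.zero ∎
    where
    0≢suc : ∀ {j : Fin n} → Fin.zero ≢ Fin.suc j
    0≢suc ()
  Σ-indicator (suc n) p (Fin.suc t) f p≐t = begin
    adjEntry (p Fin.zero) * f Fin.zero + Σ[< n ] (λ j → adjEntry (p (Fin.suc j)) * f (Fin.suc j))
      ≡⟨ cong₂ _+_ (cong (_* f Fin.zero) (adjEntry-false (λ p0 → suc≢0 (to (p≐t Fin.zero) p0))))
                   (Σ-indicator n (p ∘ Fin.suc) t (f ∘ Fin.suc) p≐t′) ⟩
    0ℚ * f Fin.zero + f (Fin.suc t)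
      ≡⟨ trans (cong (_+ f (Fin.suc t)) (*-zeroˡ (f Fin.zero))) (+-identityˡ (f (Fin.suc t))) ⟩
    f (Fin.suc t) ∎
    where
    suc≢0 : Fin.suc t ≢ Fin.zero
    suc≢0 ()
    p≐t′ : ∀ j → T (p (Fin.suc j)) ⇔ t ≡ j
    p≐t′ j = mk⇔ (FinP.suc-injective ∘ to (p≐t (Fin.suc j))) (from (p≐t (Fin.suc j)) ∘ cong Fin.suc)

  Σ-indicator₃ : ∀ n (p q r : Fin n → Bool) (s t u : Fin n) (f : Fin n → ℚ) →
    (∀ j → T (p j) ⇔ s ≡ j) → (∀ j → T (q j) ⇔ t ≡ j) → (∀ j → T (r j) ⇔ u ≡ j) →
    s ≢ t → s ≢ u → t ≢ u →
    Σ[< n ] (λ j → adjEntry (p j ∨ (q j ∨ r j)) * f j) ≡ f s + (f t + f u)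
  Σ-indicator₃ n p q r s t u f p≐s q≐t r≐u s≢t s≢u t≢u = begin
    Σ[< n ] (λ j → adjEntry (p j ∨ (q j ∨ r j)) * f j)
      ≡⟨ Σ-cong n split ⟩
    Σ[< n ] (λ j → P j + (Q j + R j))
      ≡⟨ trans (Σ-+ n P _) (cong (Σ[< n ] P +_) (Σ-+ n Q R)) ⟩
    Σ[< n ] P + (Σ[< n ] Q + Σ[< n ] R)
      ≡⟨ cong₂ _+_ (Σ-indicator n p s f p≐s)
                   (cong₂ _+_ (Σ-indicator n q t f q≐t) (Σ-indicator n r u f r≐u)) ⟩
    f s + (f t + f u) ∎
    where
    P Q R : Fin n → ℚ
    P j = adjEntry (p j) * f j
    Q j = adjEntry (q j) * f j
    R j = adjEntry (r j) * f j
    apart : ∀ {a b : Fin n → Bool} {v w} → (∀ j → T (a j) ⇔ v ≡ j) → (∀ j → T (b j) ⇔ w ≡ j) →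
      v ≢ w → ∀ j → T (a j) → T (b j) → ⊥
    apart a≐v b≐w v≢w j aj bj = v≢w (trans (to (a≐v j) aj) (sym (to (b≐w j) bj)))
    p#qr : ∀ j → T (p j) → T (q j ∨ r j) → ⊥
    p#qr j pj qrj with to T-∨ qrj
    ... | inj₁ qj = apart p≐s q≐t s≢t j pj qj
    ... | inj₂ rj = apart p≐s r≐u s≢u j pj rj
    split : ∀ j → adjEntry (p j ∨ (q j ∨ r j)) * f j ≡ P j + (Q j + R j)
    split j = begin
      adjEntry (p j ∨ (q j ∨ r j)) * f j
        ≡⟨ cong (_* f j) (trans (adjEntry-∨ (p#qr j))
                                (cong (adjEntry (p j) +_) (adjEntry-∨ (apart q≐t r≐u t≢u j)))) ⟩
      (adjEntry (p j) + (adjEntry (q j) + adjEntry (r j))) * f j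
        ≡⟨ solve 4 (λ x y z w → (x :+ (y :+ z)) :* w := x :* w :+ (y :* w :+ z :* w)) refl
             (adjEntry (p j)) (adjEntry (q j)) (adjEntry (r j)) (f j) ⟩
      P j + (Q j + R j) ∎

module Congruences where
  open import Data.Integer using (ℤ; +_; 0ℤ; _+_; _-_; -_; _*_; _%ℕ_; _/ℕ_; ∣_∣; _⊖_)
  import Data.Integer.Properties as ℤ
  open import Data.Integer.DivMod using (n%ℕd<d; a≡a%ℕn+[a/ℕn]*n)
  open import Data.Nat.DivMod using (m<n⇒m%n≡m)
  open import Data.Integer.Divisibility.Signed
    using (_∣_; _∣?_; divides; ∣m∣n⇒∣m+n; ∣m⇒∣-m; ∣-trans; ∣⇒∣ᵤ; ∣ᵤ⇒∣)
  open import Relation.Nullary.Decidable using (Dec; map′)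
  import Data.Nat.Divisibility as ℕ
  import Data.Nat.Properties as ℕ
  open ℤ-Solver

  infix 4 _≡_mod_
  -- A record rather than an abbreviation of + k ∣ i - j, so that i and j can be inferred.
  record _≡_mod_ (i j : ℤ) (k : ℕ) : Set where
    constructor by-divisibility
    field divides-difference : + k ∣ i - j
  open _≡_mod_ public

  module _ {k : ℕ} where

    ≡-mod-reflexive : ∀ {i j} → i ≡ j → i ≡ j mod k
    ≡-mod-reflexive i≡j = by-divisibility (divides 0ℤ (ℤ.i≡j⇒i-j≡0 i≡j))

    ≡-mod-refl : ∀ {i} → i ≡ i mod k
    ≡-mod-refl = ≡-mod-reflexive refl

    ≡-mod-sym : ∀ {i j} → i ≡ j mod k → j ≡ i mod k
    ≡-mod-sym {i} {j} (by-divisibility k∣i-j) =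
      by-divisibility (subst (+ k ∣_) (solve 2 (λ i j → :- (i :- j) := j :- i) refl i j) (∣m⇒∣-m k∣i-j))

    ≡-mod-trans : ∀ {i j l} → i ≡ j mod k → j ≡ l mod k → i ≡ l mod k
    ≡-mod-trans {i} {j} {l} (by-divisibility k∣i-j) (by-divisibility k∣j-l) = by-divisibility
      (subst (+ k ∣_) (solve 3 (λ i j l → (i :- j) :+ (j :- l) := i :- l) refl i j l) (∣m∣n⇒∣m+n k∣i-j k∣j-l))

    +-cong-mod : ∀ {i j i′ j′} → i ≡ j mod k → i′ ≡ j′ mod k → i + i′ ≡ j + j′ mod k
    +-cong-mod {i} {j} {i′} {j′} (by-divisibility k∣i-j) (by-divisibility k∣i′-j′) = by-divisibility
      (subst (+ k ∣_) (solve 4 (λ i j i′ j′ → (i :- j) :+ (i′ :- j′) := (i :+ i′) :- (j :+ j′)) refl i j i′ j′)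
        (∣m∣n⇒∣m+n k∣i-j k∣i′-j′))

    neg-cong-mod : ∀ {i j} → i ≡ j mod k → - i ≡ - j mod k
    neg-cong-mod {i} {j} (by-divisibility k∣i-j) = by-divisibility
      (subst (+ k ∣_) (solve 2 (λ i j → :- (i :- j) := (:- i) :- (:- j)) refl i j) (∣m⇒∣-m k∣i-j))

    minus-cong-mod : ∀ {i j i′ j′} → i ≡ j mod k → i′ ≡ j′ mod k → i - i′ ≡ j - j′ mod k
    minus-cong-mod i≡j i′≡j′ = +-cong-mod i≡j (neg-cong-mod i′≡j′)

    ≡-mod-multiple : ∀ i {c} → + k ∣ c → i + c ≡ i mod k
    ≡-mod-multiple i {c} k∣c = by-divisibility (subst (+ k ∣_) (solve 2 (λ i c → c := (i :+ c) :- i) refl i c) k∣c)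

    +multiple-≡-mod : ∀ i {c} → k ℕ.∣ c → i + + c ≡ i mod k
    +multiple-≡-mod i k∣c = ≡-mod-multiple i (∣ᵤ⇒∣ k∣c)

    minus-multiple-≡-mod : ∀ i {c} → k ℕ.∣ c → i - + c ≡ i mod k
    minus-multiple-≡-mod i k∣c = ≡-mod-multiple i (∣m⇒∣-m (∣ᵤ⇒∣ k∣c))

    ≡-mod-transpose : ∀ {i j c} → (i + c ≡ j mod k) ⇔ (j - c ≡ i mod k)
    ≡-mod-transpose {i} {j} {c} = mk⇔
      (λ i+c≡j → ≡-mod-sym (≡-mod-trans (≡-mod-reflexive (solve 2 (λ i c → i := i :+ c :- c) refl i c))
                                        (minus-cong-mod i+c≡j ≡-mod-refl)))
      (λ j-c≡i → ≡-mod-trans (+-cong-mod (≡-mod-sym j-c≡i) ≡-mod-refl)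
                             (≡-mod-reflexive (solve 2 (λ j c → j :- c :+ c := j) refl j c)))

    ≡-mod-weaken : ∀ {d i j} → d ℕ.∣ k → i ≡ j mod k → i ≡ j mod d
    ≡-mod-weaken d∣k (by-divisibility k∣i-j) = by-divisibility (∣-trans (∣ᵤ⇒∣ d∣k) k∣i-j)

    +-≢-mod : ∀ i {n} → 0 ℕ.< n → n ℕ.< k → ¬ (i + + n ≡ i mod k)
    +-≢-mod i {n} 0<n n<k i+n≡i = ℕ.>⇒∤ {{ℕ.>-nonZero 0<n}} n<k (∣⇒∣ᵤ k∣n)
      where
      k∣n : + k ∣ + n
      k∣n = subst (+ k ∣_) (solve 2 (λ i n → (i :+ n) :- i := n) refl i (+ n)) (divides-difference i+n≡i)

    ≡-mod-<⇒≡ : ∀ {r r′} → r ℕ.< k → r′ ℕ.< k → + r ≡ + r′ mod k → r ≡ r′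
    ≡-mod-<⇒≡ {r} {r′} r<k r′<k r≡r′ =
      ℤ.+-injective (ℤ.i-j≡0⇒i≡j (+ r) (+ r′) (trans (ℤ.m-n≡m⊖n r r′) r⊖r′≡0))
      where
      gap : ℕ
      gap = ∣ r ⊖ r′ ∣
      gap<k : gap ℕ.< k
      gap<k = ℕ.≤-<-trans (ℤ.∣m⊝n∣≤m⊔n r r′) (ℕ.⊔-lub r<k r′<k)
      k∣gap : k ℕ.∣ gap
      k∣gap = subst (k ℕ.∣_) (cong ∣_∣ (ℤ.m-n≡m⊖n r r′)) (∣⇒∣ᵤ (divides-difference r≡r′))
      gap≡0 : gap ≡ 0
      gap≡0 with gap in eq
      ... | zero  = refl
      ... | suc _ = ⊥-elim (ℕ.>⇒∤ (subst (ℕ._< k) eq gap<k) (subst (k ℕ.∣_) eq k∣gap))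
      r⊖r′≡0 : r ⊖ r′ ≡ 0ℤ
      r⊖r′≡0 = ℤ.∣i∣≡0⇒i≡0 gap≡0

  module _ {k : ℕ} {{_ : NonZero k}} where

    ≡-mod-%ℕ : ∀ i → i ≡ + (i %ℕ k) mod k
    ≡-mod-%ℕ i = by-divisibility (divides (i /ℕ k) (begin
      i - + (i %ℕ k)                     ≡⟨ cong (_- + (i %ℕ k)) (a≡a%ℕn+[a/ℕn]*n i k) ⟩
      + (i %ℕ k) + i /ℕ k * + k - + (i %ℕ k)
        ≡⟨ solve 3 (λ r q k → r :+ q :* k :- r := q :* k) refl (+ (i %ℕ k)) (i /ℕ k) (+ k) ⟩
      i /ℕ k * + k ∎))
      where open ≡-Reasoning

    %ℕ-cong : ∀ {i j} → i ≡ j mod k → i %ℕ k ≡ j %ℕ k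
    %ℕ-cong {i} {j} i≡j = ≡-mod-<⇒≡ (n%ℕd<d i k) (n%ℕd<d j k)
      (≡-mod-trans (≡-mod-sym (≡-mod-%ℕ i)) (≡-mod-trans i≡j (≡-mod-%ℕ j)))

  ≡-mod? : ∀ k i j → Dec (i ≡ j mod k)
  ≡-mod? k i j = map′ by-divisibility divides-difference (+ k ∣? i - j)

  ≡-mod⇒∣∸ : ∀ {k m n} → n ℕ.≤ m → + m ≡ + n mod k → k ℕ.∣ m ℕ.∸ n
  ≡-mod⇒∣∸ {k} {m} {n} n≤m (by-divisibility k∣m-n) =
    subst (k ℕ.∣_) (cong ∣_∣ (trans (ℤ.m-n≡m⊖n m n) (ℤ.⊖-≥ n≤m))) (∣⇒∣ᵤ k∣m-n)

  residue : ∀ k {{_ : NonZero k}} → ℤ → Fin k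
  residue k i = Fin.fromℕ< (n%ℕd<d i k)

  module _ {k : ℕ} {{_ : NonZero k}} where

    toℕ-residue : ∀ i → toℕ (residue k i) ≡ i %ℕ k
    toℕ-residue i = FinP.toℕ-fromℕ< (n%ℕd<d i k)

    ≡-mod-residue : ∀ i → i ≡ + toℕ (residue k i) mod k
    ≡-mod-residue i = ≡-mod-trans (≡-mod-%ℕ i) (≡-mod-reflexive (cong +_ (sym (toℕ-residue i))))

    residue-cong : ∀ {i j} → i ≡ j mod k → residue k i ≡ residue k j
    residue-cong i≡j = FinP.fromℕ<-cong _ _ (%ℕ-cong i≡j) _ _

    residue-toℕ : ∀ r → residue k (+ toℕ r) ≡ r
    residue-toℕ r = FinP.toℕ-injective (trans (toℕ-residue (+ toℕ r)) (m<n⇒m%n≡m (FinP.toℕ<n r)))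

    residue-injective : ∀ {i j} → residue k i ≡ residue k j → i ≡ j mod k
    residue-injective {i} {j} i↦r = ≡-mod-trans (≡-mod-residue i)
      (≡-mod-trans (≡-mod-reflexive (cong (+_ ∘ toℕ) i↦r)) (≡-mod-sym (≡-mod-residue j)))

    residue≡⇔ : ∀ {i r} → (residue k i ≡ r) ⇔ (i ≡ + toℕ r mod k)
    residue≡⇔ {i} {r} = mk⇔
      (λ i↦r → ≡-mod-trans (≡-mod-residue i) (≡-mod-reflexive (cong (+_ ∘ toℕ) i↦r)))
      (λ i≡r → trans (residue-cong i≡r) (residue-toℕ r))

    residue-spec : ∀ i r → T (i %ℕ k ℕ.≡ᵇ toℕ r) ⇔ residue k i ≡ r
    residue-spec i r = mk⇔
      (λ t → FinP.toℕ-injective (trans (toℕ-residue i) (ℕ.≡ᵇ⇒≡ _ _ t)))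
      (λ i↦r → ℕ.≡⇒≡ᵇ _ _ (trans (sym (toℕ-residue i)) (cong toℕ i↦r)))

  Periodic : ∀ {A : Set} → ℕ → (ℤ → A) → Set
  Periodic k F = ∀ {i j} → i ≡ j mod k → F i ≡ F j

  periodic-weaken : ∀ {A : Set} {d k} {F : ℤ → A} → d ℕ.∣ k → Periodic d F → Periodic k F
  periodic-weaken d∣k F-periodic = F-periodic ∘ ≡-mod-weaken d∣k

module Signs where
  open import Algebra.Bundles using (CommutativeRing)
  open import Data.Nat.Divisibility using (_∣_; _∣?_; divides-refl; m%n≡0⇒n∣m)
  open import Data.Nat.DivMod using (_%_; _/_; m≡m%n+[m/n]*n; m%n<n)
  open import Data.Rational using (ℚ; 0ℚ; 1ℚ; _+_; _*_; -_; _-_; 1/_; ≢-nonZero)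
  open import Data.Rational.Properties
    using (_≟_; +-*-commutativeRing; *-inverseˡ; *-identityˡ; *-assoc; *-zeroʳ; +-inverseʳ; +-identityˡ)
  open ℚ-Solver
  open ≡-Reasoning
  open import Algebra.Properties.Semiring.Exp (CommutativeRing.semiring +-*-commutativeRing) public
    using (_^_)

  p*q≡0⇒q≡0 : ∀ {p q} → p ≢ 0ℚ → p * q ≡ 0ℚ → q ≡ 0ℚ
  p*q≡0⇒q≡0 {p} {q} p≢0 p*q≡0 = begin
    q                ≡⟨ sym (*-identityˡ q) ⟩
    1ℚ * q           ≡⟨ cong (_* q) (sym (*-inverseˡ p)) ⟩
    (1/ p) * p * q   ≡⟨ *-assoc (1/ p) p q ⟩
    (1/ p) * (p * q) ≡⟨ cong ((1/ p) *_) p*q≡0 ⟩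
    (1/ p) * 0ℚ      ≡⟨ *-zeroʳ (1/ p) ⟩
    0ℚ               ∎
    where instance _ = ≢-nonZero p≢0

  p≡d*p⇒d≡1 : ∀ {d p} → p ≢ 0ℚ → p ≡ d * p → d ≡ 1ℚ
  p≡d*p⇒d≡1 {d} {p} p≢0 p≡dp = begin
    d                ≡⟨ solve 1 (λ d → d := (d :- con 1ℚ) :+ con 1ℚ) refl d ⟩
    (d - 1ℚ) + 1ℚ    ≡⟨ cong (_+ 1ℚ) (p*q≡0⇒q≡0 p≢0 p[d-1]≡0) ⟩
    0ℚ + 1ℚ          ≡⟨ +-identityˡ 1ℚ ⟩
    1ℚ               ∎
    where
    p[d-1]≡0 : p * (d - 1ℚ) ≡ 0ℚ
    p[d-1]≡0 = begin
      p * (d - 1ℚ) ≡⟨ solve 2 (λ p d → p :* (d :- con 1ℚ) := d :* p :- p) refl p d ⟩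
      d * p - p    ≡⟨ cong (_- p) (sym p≡dp) ⟩
      p - p        ≡⟨ +-inverseʳ p ⟩
      0ℚ           ∎

  linked-product : ∀ {u v p q} → p ≢ 0ℚ → u * p + q ≡ 0ℚ → v * q + p ≡ 0ℚ → u * v ≡ 1ℚ
  linked-product {u} {v} {p} {q} p≢0 up+q≡0 vq+p≡0 = p≡d*p⇒d≡1 p≢0 (begin
    p                            ≡⟨ solve 4 (λ u v p q → p := u :* v :* p :- v :* (u :* p :+ q) :+ (v :* q :+ p))
                                      refl u v p q ⟩
    u * v * p - v * (u * p + q) + (v * q + p) ≡⟨ cong₂ (λ x y → u * v * p - v * x + y) up+q≡0 vq+p≡0 ⟩
    u * v * p - v * 0ℚ + 0ℚ
      ≡⟨ solve 3 (λ u v p → u :* v :* p :- v :* con 0ℚ :+ con 0ℚ := u :* v :* p) refl u v p ⟩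
    u * v * p                    ∎)

  IsSign : ℚ → Set
  IsSign s = s ≡ 1ℚ ⊎ s ≡ - 1ℚ

  square≡1⇒IsSign : ∀ {c} → c * c ≡ 1ℚ → IsSign c
  square≡1⇒IsSign {c} c²≡1 with c ≟ 1ℚ
  ... | yes c≡1 = inj₁ c≡1
  ... | no  c≢1 = inj₂ (begin
    c                       ≡⟨ solve 1 (λ c → c := (c :+ con 1ℚ) :- con 1ℚ) refl c ⟩
    (c + 1ℚ) - 1ℚ           ≡⟨ cong (_- 1ℚ) (p*q≡0⇒q≡0 c-1≢0 [c-1][c+1]≡0) ⟩
    0ℚ - 1ℚ                 ≡⟨ +-identityˡ (- 1ℚ) ⟩
    - 1ℚ                    ∎)
    where
    c-1≢0 : c - 1ℚ ≢ 0ℚ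
    c-1≢0 c-1≡0 = c≢1 (trans (solve 1 (λ c → c := (c :- con 1ℚ) :+ con 1ℚ) refl c)
                             (trans (cong (_+ 1ℚ) c-1≡0) (+-identityˡ 1ℚ)))
    [c-1][c+1]≡0 : (c - 1ℚ) * (c + 1ℚ) ≡ 0ℚ
    [c-1][c+1]≡0 = begin
      (c - 1ℚ) * (c + 1ℚ) ≡⟨ solve 1 (λ c → (c :- con 1ℚ) :* (c :+ con 1ℚ) := c :* c :- con 1ℚ) refl c ⟩
      c * c - 1ℚ          ≡⟨ cong (_- 1ℚ) c²≡1 ⟩
      1ℚ - 1ℚ             ≡⟨ +-inverseʳ 1ℚ ⟩
      0ℚ                  ∎

  IsSign⇒square≡1 : ∀ {s} → IsSign s → s * s ≡ 1ℚ
  IsSign⇒square≡1 (inj₁ refl) = refl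
  IsSign⇒square≡1 (inj₂ refl) = refl

  IsSign-^ : ∀ {c} → IsSign c → ∀ n → IsSign (c ^ n)
  IsSign-^ c-sign zero = inj₁ refl
  IsSign-^ {c} c-sign (suc n) with c-sign | IsSign-^ c-sign n
  ... | inj₁ refl | inj₁ eq = inj₁ (cong (1ℚ *_) eq)
  ... | inj₁ refl | inj₂ eq = inj₂ (cong (1ℚ *_) eq)
  ... | inj₂ refl | inj₁ eq = inj₂ (cong (- 1ℚ *_) eq)
  ... | inj₂ refl | inj₂ eq = inj₁ (cong (- 1ℚ *_) eq)

  sign-equation : ∀ {s t u} → IsSign s → IsSign t → IsSign u →
    (s + s + u) * (t + t + u) ≡ 1ℚ → s ≡ t × u ≡ - s
  sign-equation (inj₁ refl) (inj₁ refl) (inj₁ refl) ()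
  sign-equation (inj₁ refl) (inj₁ refl) (inj₂ refl) _  = refl , refl
  sign-equation (inj₁ refl) (inj₂ refl) (inj₁ refl) ()
  sign-equation (inj₁ refl) (inj₂ refl) (inj₂ refl) ()
  sign-equation (inj₂ refl) (inj₁ refl) (inj₁ refl) ()
  sign-equation (inj₂ refl) (inj₁ refl) (inj₂ refl) ()
  sign-equation (inj₂ refl) (inj₂ refl) (inj₁ refl) _  = refl , refl
  sign-equation (inj₂ refl) (inj₂ refl) (inj₂ refl) ()

  1^n≡1 : ∀ n → 1ℚ ^ n ≡ 1ℚ
  1^n≡1 zero    = refl
  1^n≡1 (suc n) = cong (1ℚ *_) (1^n≡1 n)

  -1^[2q]≡1 : ∀ q → (- 1ℚ) ^ (q ℕ.* 2) ≡ 1ℚ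
  -1^[2q]≡1 zero    = refl
  -1^[2q]≡1 (suc q) = cong (λ x → - 1ℚ * (- 1ℚ * x)) (-1^[2q]≡1 q)

  odd≡1+2q : ∀ {n} → ¬ 2 ∣ n → n ≡ suc (n / 2 ℕ.* 2)
  odd≡1+2q {n} 2∤n = trans (m≡m%n+[m/n]*n n 2) (cong (ℕ._+ n / 2 ℕ.* 2) (n%2≡1 (n % 2) refl (m%n<n n 2)))
    where
    n%2≡1 : ∀ r → n % 2 ≡ r → r ℕ.< 2 → r ≡ 1
    n%2≡1 zero    n%2≡0 _ = ⊥-elim (2∤n (m%n≡0⇒n∣m n 2 n%2≡0))
    n%2≡1 (suc zero) _ _ = refl
    n%2≡1 (suc (suc _)) _ (ℕ.s≤s (ℕ.s≤s ()))

  -1^even : ∀ {n} → 2 ∣ n → (- 1ℚ) ^ n ≡ 1ℚ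
  -1^even (divides-refl q) = -1^[2q]≡1 q

  -1^odd : ∀ {n} → ¬ 2 ∣ n → (- 1ℚ) ^ n ≡ - 1ℚ
  -1^odd {n} 2∤n = begin
    (- 1ℚ) ^ n                       ≡⟨ cong ((- 1ℚ) ^_) (odd≡1+2q 2∤n) ⟩
    - 1ℚ * (- 1ℚ) ^ (n / 2 ℕ.* 2)    ≡⟨ cong (- 1ℚ *_) (-1^[2q]≡1 (n / 2)) ⟩
    - 1ℚ                             ∎

  1≢-1 : 1ℚ ≢ - 1ℚ
  1≢-1 ()

  -1^n≡1⇒2∣n : ∀ {n} → (- 1ℚ) ^ n ≡ 1ℚ → 2 ∣ n
  -1^n≡1⇒2∣n {n} -1^n≡1 with 2 ∣? n
  ... | yes 2∣n = 2∣n
  ... | no  2∤n = ⊥-elim (1≢-1 (trans (sym -1^n≡1) (-1^odd 2∤n)))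

  -1^n≡-1⇒2∤n : ∀ {n} → (- 1ℚ) ^ n ≡ - 1ℚ → ¬ 2 ∣ n
  -1^n≡-1⇒2∤n -1^n≡-1 2∣n = 1≢-1 (trans (sym (-1^even 2∣n)) -1^n≡-1)

  sign-powers-parity : ∀ {c} a b h → IsSign c → c ^ a ≡ c ^ b → c ^ h ≡ - c ^ a →
    (2 ∣ a × 2 ∣ b × ¬ 2 ∣ h) ⊎ (¬ 2 ∣ a × ¬ 2 ∣ b × 2 ∣ h)
  sign-powers-parity a b h (inj₁ refl) _ h≡-a =
    ⊥-elim (1≢-1 (trans (sym (1^n≡1 h)) (trans h≡-a (cong -_ (1^n≡1 a)))))
  sign-powers-parity a b h (inj₂ refl) a≡b h≡-a with 2 ∣? a
  ... | yes 2∣a = inj₁ (2∣a , -1^n≡1⇒2∣n (trans (sym a≡b) (-1^even 2∣a))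
                            , -1^n≡-1⇒2∤n (trans h≡-a (cong -_ (-1^even 2∣a))))
  ... | no  2∤a = inj₂ (2∤a , -1^n≡-1⇒2∤n (trans (sym a≡b) (-1^odd 2∤a))
                            , -1^n≡1⇒2∣n (trans h≡-a (cong -_ (-1^odd 2∤a))))

  geometric-parity : ∀ {c} a b h → c * c ≡ 1ℚ →
    (c ^ a + c ^ a + c ^ h) * (c ^ b + c ^ b + c ^ h) ≡ 1ℚ →
    (2 ∣ a × 2 ∣ b × ¬ 2 ∣ h) ⊎ (¬ 2 ∣ a × ¬ 2 ∣ b × 2 ∣ h)
  geometric-parity a b h c²≡1 eq = uncurry (sign-powers-parity a b h c-sign)
    (sign-equation (IsSign-^ c-sign a) (IsSign-^ c-sign b) (IsSign-^ c-sign h) eq)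
    where c-sign = square≡1⇒IsSign c²≡1

module ShiftSums where
  open Congruences
  open Signs using (_^_)
  open import Data.Integer as ℤ using (ℤ; +_; 0ℤ; 1ℤ)
  import Data.Integer.Properties as ℤ
  open import Data.Nat.Divisibility using (_∣_)
  open import Data.Rational using (ℚ; _+_; _*_)
  import Data.Rational.Properties as ℚ
  open ≡-Reasoning

  shiftSum : ℕ → (ℤ → ℚ) → ℤ → ℚ
  shiftSum s F i = F (i ℤ.+ + s) + F (i ℤ.- + s)

  shiftSum-cong : ∀ s {F G : ℤ → ℚ} → (∀ i → F i ≡ G i) → ∀ i → shiftSum s F i ≡ shiftSum s G i
  shiftSum-cong s F≗G i = cong₂ _+_ (F≗G (i ℤ.+ + s)) (F≗G (i ℤ.- + s))

  shiftSum-mod : ∀ {k F} → Periodic k F → ∀ {i j s t} → i ≡ j mod k → + s ≡ + t mod k →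
    shiftSum s F i ≡ shiftSum t F j
  shiftSum-mod F-periodic i≡j s≡t =
    cong₂ _+_ (F-periodic (+-cong-mod i≡j s≡t)) (F-periodic (minus-cong-mod i≡j s≡t))

  shiftSum-periodic : ∀ {k} s {F} → Periodic k F → Periodic k (shiftSum s F)
  shiftSum-periodic s F-periodic i≡j = shiftSum-mod F-periodic i≡j ≡-mod-refl

  BalancedAt : ℕ → ℕ → (ℤ → ℚ) → ℤ → Set
  BalancedAt a b F i = shiftSum b (shiftSum a F) i ≡ shiftSum a F i + shiftSum b F i

  Balanced : ℕ → ℕ → (ℤ → ℚ) → Set
  Balanced a b F = ∀ i → BalancedAt a b F i

  BalancedAt-mod : ∀ {k F} → Periodic k F → ∀ {a a′ b b′ i j} →
    i ≡ j mod k → + a ≡ + a′ mod k → + b ≡ + b′ mod k → BalancedAt a′ b′ F j → BalancedAt a b F i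
  BalancedAt-mod {F = F} F-periodic {a} {a′} {b} {b′} {i} {j} i≡j a≡a′ b≡b′ balanced′ = begin
    shiftSum b (shiftSum a F) i   ≡⟨ shiftSum-mod (shiftSum-periodic a F-periodic) i≡j b≡b′ ⟩
    shiftSum b′ (shiftSum a F) j  ≡⟨ shiftSum-cong b′ (λ l → shiftSum-mod F-periodic {l} ≡-mod-refl a≡a′) j ⟩
    shiftSum b′ (shiftSum a′ F) j ≡⟨ balanced′ ⟩
    shiftSum a′ F j + shiftSum b′ F j
      ≡⟨ cong₂ _+_ (shiftSum-mod F-periodic i≡j a≡a′) (shiftSum-mod F-periodic i≡j b≡b′) ⟨
    shiftSum a F i + shiftSum b F i ∎

  shiftSum-invariant : ∀ {d F} → Periodic d F → ∀ {s} → d ∣ s → ∀ i → shiftSum s F i ≡ F i + F i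
  shiftSum-invariant F-periodic d∣s i =
    cong₂ _+_ (F-periodic (+multiple-≡-mod i d∣s)) (F-periodic (minus-multiple-≡-mod i d∣s))

  balanced-of-periodic : ∀ {d F} → Periodic d F → ∀ {a b} → d ∣ a → d ∣ b → Balanced a b F
  balanced-of-periodic {F = F} F-periodic {a} {b} d∣a d∣b i = begin
    shiftSum b (shiftSum a F) i             ≡⟨ shiftSum-cong b (shiftSum-invariant F-periodic d∣a) i ⟩
    shiftSum b (λ j → F j + F j) i          ≡⟨ cong₂ _+_ (cong₂ _+_ Fb Fb) (cong₂ _+_ Fb′ Fb′) ⟩
    (F i + F i) + (F i + F i)
      ≡⟨ cong₂ _+_ (shiftSum-invariant F-periodic d∣a i) (shiftSum-invariant F-periodic d∣b i) ⟨
    shiftSum a F i + shiftSum b F i         ∎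
    where
    Fb  = F-periodic (+multiple-≡-mod i d∣b)
    Fb′ = F-periodic (minus-multiple-≡-mod i d∣b)

  Symmetric : (ℤ → ℚ) → Set
  Symmetric F = ∀ i → F (0ℤ ℤ.- i) ≡ F i

  HasRatio : ℚ → (ℤ → ℚ) → Set
  HasRatio c F = ∀ i → F (i ℤ.+ 1ℤ) ≡ c * F i

  shift-iterate : ∀ {F : ℤ → ℚ} {c} s → (∀ i → F (i ℤ.+ + s) ≡ c * F i) →
    ∀ n i → F (i ℤ.+ + (n ℕ.* s)) ≡ c ^ n * F i
  shift-iterate {F} s step zero i = trans (cong F (ℤ.+-identityʳ i)) (sym (ℚ.*-identityˡ (F i)))
  shift-iterate {F} {c} s step (suc n) i = begin
    F (i ℤ.+ + (s ℕ.+ n ℕ.* s))       ≡⟨ cong F (+-rotate i (+ s) (+ (n ℕ.* s))) ⟩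
    F (i ℤ.+ + (n ℕ.* s) ℤ.+ + s)     ≡⟨ step (i ℤ.+ + (n ℕ.* s)) ⟩
    c * F (i ℤ.+ + (n ℕ.* s))         ≡⟨ cong (c *_) (shift-iterate s step n i) ⟩
    c * (c ^ n * F i)                 ≡⟨ ℚ.*-assoc c (c ^ n) (F i) ⟨
    c ^ suc n * F i                   ∎
    where
    +-rotate : ∀ i s t → i ℤ.+ (s ℤ.+ t) ≡ i ℤ.+ t ℤ.+ s
    +-rotate = ℤ-Solver.solve 3 (λ i s t → i :+ (s :+ t) := (i :+ t) :+ s) refl
      where open ℤ-Solver

module PeriodicFunctions where
  open Congruences
  open Signs using (_^_; odd≡1+2q)
  open ShiftSums
  open import Data.Integer as ℤ using (ℤ; +_; 0ℤ; 1ℤ; _%ℕ_)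
  import Data.Integer.Properties as ℤ
  open import Data.Integer.DivMod using (n%ℕd<d)
  open import Data.Integer.Divisibility.Signed using (divides)
  open import Data.Nat.Divisibility using (_∣_; divides-refl)
  open import Data.Rational using (ℚ; 0ℚ; 1ℚ; _+_; _*_; -_)
  open import Data.Nat.DivMod using (m<n⇒m%n≡m)
  open import Data.Bool using (if_then_else_)
  open import Data.Fin.Properties using (all?)
  import Data.Rational.Properties as ℚ
  open import Relation.Nullary.Decidable using (Dec; ¬?; _×-dec_; _→-dec_; toWitness)
  open ≡-Reasoning

  alternating : ℤ → ℚ
  alternating i = (- 1ℚ) ^ (i %ℕ 2)

  alternating-periodic : Periodic 2 alternating
  alternating-periodic i≡j = cong ((- 1ℚ) ^_) (%ℕ-cong i≡j)

  alternating-+1 : ∀ i → alternating (i ℤ.+ 1ℤ) ≡ - alternating i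
  alternating-+1 i =
    trans (alternating-periodic (+-cong-mod (≡-mod-%ℕ i) ≡-mod-refl)) (flip (i %ℕ 2) (n%ℕd<d i 2))
    where
    flip : ∀ r → r ℕ.< 2 → alternating (+ r ℤ.+ 1ℤ) ≡ - (- 1ℚ) ^ r
    flip 0 _ = refl
    flip 1 _ = refl
    flip (suc (suc _)) (ℕ.s≤s (ℕ.s≤s ()))

  alternating-even-shift : ∀ {c} → 2 ∣ c → ∀ i → alternating (i ℤ.+ + c) ≡ alternating i
  alternating-even-shift 2∣c i = alternating-periodic (+multiple-≡-mod i 2∣c)

  alternating-even-shift⁻ : ∀ {c} → 2 ∣ c → ∀ i → alternating (i ℤ.- + c) ≡ alternating i
  alternating-even-shift⁻ 2∣c i = alternating-periodic (minus-multiple-≡-mod i 2∣c)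

  alternating-odd-shift : ∀ {c} → ¬ 2 ∣ c → ∀ i → alternating (i ℤ.+ + c) ≡ - alternating i
  alternating-odd-shift {c} 2∤c i = begin
    alternating (i ℤ.+ + c)                     ≡⟨ cong (λ n → alternating (i ℤ.+ + n)) (odd≡1+2q 2∤c) ⟩
    alternating (i ℤ.+ (1ℤ ℤ.+ + (q ℕ.* 2)))    ≡⟨ cong alternating (+-rotate i (+ (q ℕ.* 2))) ⟩
    alternating (i ℤ.+ 1ℤ ℤ.+ + (q ℕ.* 2))      ≡⟨ alternating-even-shift (divides-refl q) (i ℤ.+ 1ℤ) ⟩
    alternating (i ℤ.+ 1ℤ)                      ≡⟨ alternating-+1 i ⟩
    - alternating i                             ∎
    where
    q = c ℕ./ 2
    +-rotate : ∀ i t → i ℤ.+ (1ℤ ℤ.+ t) ≡ i ℤ.+ 1ℤ ℤ.+ t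
    +-rotate = solve 2 (λ i t → i :+ (con 1ℤ :+ t) := i :+ con 1ℤ :+ t) refl
      where open ℤ-Solver

  cosQuarterTurns : ℕ → ℚ
  cosQuarterTurns 0 = 1ℚ
  cosQuarterTurns 2 = - 1ℚ
  cosQuarterTurns _ = 0ℚ

  quarterWave : ℤ → ℚ
  quarterWave i = cosQuarterTurns (i %ℕ 4)

  quarterWave-periodic : Periodic 4 quarterWave
  quarterWave-periodic i≡j = cong cosQuarterTurns (%ℕ-cong i≡j)

  quarterWave-+2 : ∀ i → quarterWave (i ℤ.+ + 2) ≡ - 1ℚ * quarterWave i
  quarterWave-+2 i =
    trans (quarterWave-periodic (+-cong-mod (≡-mod-%ℕ i) ≡-mod-refl)) (half-turn (i %ℕ 4) (n%ℕd<d i 4))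
    where
    half-turn : ∀ r → r ℕ.< 4 → quarterWave (+ r ℤ.+ + 2) ≡ - 1ℚ * cosQuarterTurns r
    half-turn 0 _ = refl
    half-turn 1 _ = refl
    half-turn 2 _ = refl
    half-turn 3 _ = refl
    half-turn (suc (suc (suc (suc _)))) (ℕ.s≤s (ℕ.s≤s (ℕ.s≤s (ℕ.s≤s ()))))

  quarterWave-even-shift : ∀ q i → quarterWave (i ℤ.+ + (q ℕ.* 2)) ≡ (- 1ℚ) ^ q * quarterWave i
  quarterWave-even-shift = shift-iterate 2 quarterWave-+2

  quarterWave-odd-shiftSum : ∀ {s} → ¬ 2 ∣ s → ∀ i → shiftSum s quarterWave i ≡ 0ℚ
  quarterWave-odd-shiftSum {s} 2∤s i = begin
    quarterWave (i ℤ.+ + s) + quarterWave (i ℤ.- + s)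
      ≡⟨ cong (_+ quarterWave (i ℤ.- + s)) (trans (quarterWave-periodic across) (quarterWave-+2 (i ℤ.- + s))) ⟩
    - 1ℚ * quarterWave (i ℤ.- + s) + quarterWave (i ℤ.- + s)
      ≡⟨ cancel (quarterWave (i ℤ.- + s)) ⟩
    0ℚ ∎
    where
    cancel : ∀ x → - 1ℚ * x + x ≡ 0ℚ
    cancel = solve 1 (λ x → con (- 1ℚ) :* x :+ x := con 0ℚ) refl
      where open ℚ-Solver
    q = s ℕ./ 2
    across : i ℤ.+ + s ≡ i ℤ.- + s ℤ.+ + 2 mod 4
    across = by-divisibility (divides (+ q) (begin
      i ℤ.+ + s ℤ.- (i ℤ.- + s ℤ.+ + 2)
        ≡⟨ cong (λ t → i ℤ.+ t ℤ.- (i ℤ.- t ℤ.+ + 2))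
             (trans (cong +_ (odd≡1+2q 2∤s)) (cong (λ t → 1ℤ ℤ.+ t) (ℤ.pos-* q 2))) ⟩
      i ℤ.+ (1ℤ ℤ.+ + q ℤ.* + 2) ℤ.- (i ℤ.- (1ℤ ℤ.+ + q ℤ.* + 2) ℤ.+ + 2)
        ≡⟨ solve 2 (λ i q → let s = con 1ℤ :+ q :* con (+ 2) in i :+ s :- (i :- s :+ con (+ 2)) := q :* con (+ 4))
             refl i (+ q) ⟩
      + q ℤ.* + 4 ∎))
      where open ℤ-Solver

  divisibleBy : ∀ d {{_ : NonZero d}} → ℤ → ℚ
  divisibleBy d i = if i %ℕ d ℕ.≡ᵇ 0 then 1ℚ else 0ℚ

  module _ {d : ℕ} {{_ : NonZero d}} where

    divisibleBy-periodic : Periodic d (divisibleBy d)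
    divisibleBy-periodic i≡j = cong (λ r → if r ℕ.≡ᵇ 0 then 1ℚ else 0ℚ) (%ℕ-cong i≡j)

    divisibleBy-0 : divisibleBy d 0ℤ ≡ 1ℚ
    divisibleBy-0 = cong (λ r → if r ℕ.≡ᵇ 0 then 1ℚ else 0ℚ) (m<n⇒m%n≡m (ℕ.>-nonZero⁻¹ d))

    divisibleBy-1 : 1 ℕ.< d → divisibleBy d 1ℤ ≡ 0ℚ
    divisibleBy-1 1<d = cong (λ r → if r ℕ.≡ᵇ 0 then 1ℚ else 0ℚ) (m<n⇒m%n≡m 1<d)

  Nondegenerate5 : ℤ → ℤ → Set
  Nondegenerate5 x y = ¬ (x ≡ 0ℤ mod 5) × ¬ (y ≡ 0ℤ mod 5) × ¬ (x ≡ y mod 5) × ¬ (x ≡ ℤ.- y mod 5)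

  -- Both sides are 1 - [5 ∣ r]: when p, q, p ± q ≢ 0, both {±p, ±q} and {±p ± q} are the four
  -- nonzero residues mod 5.
  divisibleBy5-balanced-residues : ∀ (r p q : Fin 5) → Nondegenerate5 (+ toℕ p) (+ toℕ q) →
    BalancedAt (toℕ p) (toℕ q) (divisibleBy 5) (+ toℕ r)
  divisibleBy5-balanced-residues = toWitness {a? = all? λ r → all? λ p → all? λ q →
    nondegenerate? (+ toℕ p) (+ toℕ q) →-dec (lhs r p q ℚ.≟ rhs r p q)} _
    where
    nondegenerate? : ∀ x y → Dec (Nondegenerate5 x y)
    nondegenerate? x y =
      ¬? (≡-mod? 5 x 0ℤ) ×-dec ¬? (≡-mod? 5 y 0ℤ) ×-dec ¬? (≡-mod? 5 x y) ×-dec ¬? (≡-mod? 5 x (ℤ.- y))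
    lhs rhs : Fin 5 → Fin 5 → Fin 5 → ℚ
    lhs r p q = shiftSum (toℕ q) (shiftSum (toℕ p) (divisibleBy 5)) (+ toℕ r)
    rhs r p q = shiftSum (toℕ p) (divisibleBy 5) (+ toℕ r) + shiftSum (toℕ q) (divisibleBy 5) (+ toℕ r)

  Nondegenerate5-mod : ∀ {x x′ y y′} → x ≡ x′ mod 5 → y ≡ y′ mod 5 → Nondegenerate5 x y → Nondegenerate5 x′ y′
  Nondegenerate5-mod x≡x′ y≡y′ (x≢0 , y≢0 , x≢y , x≢-y) =
      (λ x′≡0 → x≢0 (≡-mod-trans x≡x′ x′≡0))
    , (λ y′≡0 → y≢0 (≡-mod-trans y≡y′ y′≡0))
    , (λ x′≡y′ → x≢y (≡-mod-trans x≡x′ (≡-mod-trans x′≡y′ (≡-mod-sym y≡y′))))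
    , (λ x′≡-y′ → x≢-y (≡-mod-trans x≡x′ (≡-mod-trans x′≡-y′ (neg-cong-mod (≡-mod-sym y≡y′)))))

  nondegenerate5 : ∀ {a b} → a ℕ.≤ b → ¬ 5 ∣ a → ¬ 5 ∣ b → ¬ 5 ∣ b ℕ.∸ a → ¬ 5 ∣ a ℕ.+ b →
    Nondegenerate5 (+ a) (+ b)
  nondegenerate5 {a} {b} a≤b 5∤a 5∤b 5∤b-a 5∤a+b =
      (λ a≡0 → 5∤a (≡-mod⇒∣∸ ℕ.z≤n a≡0))
    , (λ b≡0 → 5∤b (≡-mod⇒∣∸ ℕ.z≤n b≡0))
    , (λ a≡b → 5∤b-a (≡-mod⇒∣∸ a≤b (≡-mod-sym a≡b)))
    , (λ a≡-b → 5∤a+b (≡-mod⇒∣∸ ℕ.z≤n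
        (≡-mod-trans (+-cong-mod a≡-b (≡-mod-refl {i = + b})) (≡-mod-reflexive (ℤ.+-inverseˡ (+ b))))))

  divisibleBy5-balanced : ∀ {a b} → Nondegenerate5 (+ a) (+ b) → Balanced a b (divisibleBy 5)
  divisibleBy5-balanced {a} {b} nondegenerate i =
    BalancedAt-mod divisibleBy-periodic (≡-mod-residue i) (≡-mod-residue (+ a)) (≡-mod-residue (+ b))
      (divisibleBy5-balanced-residues (residue 5 i) (residue 5 (+ a)) (residue 5 (+ b))
        (Nondegenerate5-mod (≡-mod-residue (+ a)) (≡-mod-residue (+ b)) nondegenerate))

module Equations (h a b : ℕ) where
  open Congruences
  open ShiftSums
  open PeriodicFunctions
  open Signs using (_^_)
  open import Data.Integer as ℤ using (ℤ; +_; 0ℤ)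
  import Data.Nat.Properties as ℕ
  open import Data.Nat.Divisibility using (_∣_; ∣-refl)
  open import Data.Rational using (ℚ; 0ℚ; 1ℚ; _+_; _*_; -_)
  import Data.Rational.Properties as ℚ
  open ≡-Reasoning

  adjSum : ℕ → (ℤ → ℚ) → (ℤ → ℚ) → ℤ → ℚ
  adjSum s F G i = shiftSum s F i + F (i ℤ.+ + h) + G i

  IsSolution : (ℤ → ℚ) → (ℤ → ℚ) → Set
  IsSolution F G = (∀ i → adjSum a F G i ≡ 0ℚ) × (∀ i → adjSum b G F i ≡ 0ℚ)

  adjSum-cong : ∀ s {F F′ G G′ : ℤ → ℚ} → (∀ i → F i ≡ F′ i) → (∀ i → G i ≡ G′ i) →
    ∀ i → adjSum s F G i ≡ adjSum s F′ G′ i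
  adjSum-cong s F≗F′ G≗G′ i = cong₂ _+_ (cong₂ _+_ (shiftSum-cong s F≗F′ i) (F≗F′ (i ℤ.+ + h))) (G≗G′ i)

  adjSum-periodic : ∀ {k} s {F G} → Periodic k F → Periodic k G → Periodic k (adjSum s F G)
  adjSum-periodic s F-periodic G-periodic i≡j = cong₂ _+_
    (cong₂ _+_ (shiftSum-periodic s F-periodic i≡j) (F-periodic (+-cong-mod i≡j ≡-mod-refl))) (G-periodic i≡j)

  reflect-adjSum : ∀ s {F : ℤ → ℚ} {G} → Periodic (h ℕ.+ h) F →
    ∀ k i → adjSum s (λ j → F (k ℤ.- j)) (λ j → G (k ℤ.- j)) i ≡ adjSum s F G (k ℤ.- i)
  reflect-adjSum s {F} {G} F-periodic k i = begin
    F (k ℤ.- (i ℤ.+ + s)) + F (k ℤ.- (i ℤ.- + s)) + F (k ℤ.- (i ℤ.+ + h)) + G (k ℤ.- i)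
      ≡⟨ cong₂ (λ x y → x + y + F (k ℤ.- (i ℤ.+ + h)) + G (k ℤ.- i))
           (cong F (solve 3 (λ k i s → k :- (i :+ s) := (k :- i) :- s) refl k i (+ s)))
           (cong F (solve 3 (λ k i s → k :- (i :- s) := (k :- i) :+ s) refl k i (+ s))) ⟩
    F (k ℤ.- i ℤ.- + s) + F (k ℤ.- i ℤ.+ + s) + F (k ℤ.- (i ℤ.+ + h)) + G (k ℤ.- i)
      ≡⟨ cong₂ (λ x y → x + y + G (k ℤ.- i))
           (ℚ.+-comm (F (k ℤ.- i ℤ.- + s)) (F (k ℤ.- i ℤ.+ + s))) (F-periodic half-turn) ⟩
    F (k ℤ.- i ℤ.+ + s) + F (k ℤ.- i ℤ.- + s) + F (k ℤ.- i ℤ.+ + h) + G (k ℤ.- i) ∎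
    where
    open ℤ-Solver
    half-turn : k ℤ.- (i ℤ.+ + h) ≡ k ℤ.- i ℤ.+ + h mod (h ℕ.+ h)
    half-turn = ≡-mod-trans
      (≡-mod-reflexive (solve 3 (λ k i h → k :- (i :+ h) := (k :- i :+ h) :- (h :+ h)) refl k i (+ h)))
      (minus-multiple-≡-mod (k ℤ.- i ℤ.+ + h) ∣-refl)

  reflect-solution : ∀ {F G} → Periodic (h ℕ.+ h) F → Periodic (h ℕ.+ h) G → IsSolution F G →
    ∀ k → IsSolution (λ j → F (k ℤ.- j)) (λ j → G (k ℤ.- j))
  reflect-solution {F} {G} F-periodic G-periodic (x-equation , y-equation) k =
      (λ i → trans (reflect-adjSum a {G = G} F-periodic k i) (x-equation (k ℤ.- i)))
    , (λ i → trans (reflect-adjSum b {G = F} G-periodic k i) (y-equation (k ℤ.- i)))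

  geometric-adjSum : ∀ {F G : ℤ → ℚ} {c} s → HasRatio c F → Symmetric F →
    adjSum s F G 0ℤ ≡ (c ^ s + c ^ s + c ^ h) * F 0ℤ + G 0ℤ
  geometric-adjSum {F} {G} {c} s step symmetric = begin
    F (+ s) + F (0ℤ ℤ.- + s) + F (+ h) + G 0ℤ
      ≡⟨ cong₂ (λ x y → x + y + F (+ h) + G 0ℤ) (power s) (trans (symmetric (+ s)) (power s)) ⟩
    c ^ s * F 0ℤ + c ^ s * F 0ℤ + F (+ h) + G 0ℤ
      ≡⟨ cong (λ y → c ^ s * F 0ℤ + c ^ s * F 0ℤ + y + G 0ℤ) (power h) ⟩
    c ^ s * F 0ℤ + c ^ s * F 0ℤ + c ^ h * F 0ℤ + G 0ℤ
      ≡⟨ solve 4 (λ p q f g → p :* f :+ p :* f :+ q :* f :+ g := (p :+ p :+ q) :* f :+ g) refl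
           (c ^ s) (c ^ h) (F 0ℤ) (G 0ℤ) ⟩
    (c ^ s + c ^ s + c ^ h) * F 0ℤ + G 0ℤ ∎
    where
    open ℚ-Solver
    power : ∀ n → F (+ n) ≡ c ^ n * F 0ℤ
    power n = trans (cong (F ∘ +_) (sym (ℕ.*-identityʳ n))) (shift-iterate 1 step n 0ℤ)

  -- The y-values forced by the x-equations once G (i + h) ≡ κ * G i.
  companion : ℚ → (ℤ → ℚ) → ℤ → ℚ
  companion κ G i = - (shiftSum a G i + κ * G i)

  companion-periodic : ∀ {k} κ {G} → Periodic k G → Periodic k (companion κ G)
  companion-periodic κ G-periodic i≡j =
    cong₂ (λ x y → - (x + κ * y)) (shiftSum-periodic a G-periodic i≡j) (G-periodic i≡j)

  shiftSum-half-eigen : ∀ κ G → (∀ i → G (i ℤ.+ + h) ≡ κ * G i) →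
    ∀ s i → shiftSum s G (i ℤ.+ + h) ≡ κ * shiftSum s G i
  shiftSum-half-eigen κ G eigen s i = begin
    G (i ℤ.+ + h ℤ.+ + s) + G (i ℤ.+ + h ℤ.- + s)
      ≡⟨ cong₂ _+_ (cong G (solve 3 (λ i h s → i :+ h :+ s := i :+ s :+ h) refl i (+ h) (+ s)))
                   (cong G (solve 3 (λ i h s → i :+ h :- s := i :- s :+ h) refl i (+ h) (+ s))) ⟩
    G (i ℤ.+ + s ℤ.+ + h) + G (i ℤ.- + s ℤ.+ + h)
      ≡⟨ cong₂ _+_ (eigen (i ℤ.+ + s)) (eigen (i ℤ.- + s)) ⟩
    κ * G (i ℤ.+ + s) + κ * G (i ℤ.- + s)
      ≡⟨ ℚ.*-distribˡ-+ κ (G (i ℤ.+ + s)) (G (i ℤ.- + s)) ⟨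
    κ * shiftSum s G i ∎
    where open ℤ-Solver

  eigen-solution : ∀ κ G → (∀ i → G (i ℤ.+ + h) ≡ κ * G i) → κ * κ ≡ 1ℚ →
    (∀ i → shiftSum b (shiftSum a G) i + κ * (shiftSum a G i + shiftSum b G i) ≡ 0ℚ) →
    IsSolution G (companion κ G)
  eigen-solution κ G eigen κ²≡1 balance = x-equation , y-equation
    where
    H : ℤ → ℚ
    H = companion κ G
    x-equation : ∀ i → adjSum a G H i ≡ 0ℚ
    x-equation i = begin
      shiftSum a G i + G (i ℤ.+ + h) + H i                    ≡⟨ cong (λ t → shiftSum a G i + t + H i) (eigen i) ⟩
      shiftSum a G i + κ * G i + - (shiftSum a G i + κ * G i) ≡⟨ ℚ.+-inverseʳ (shiftSum a G i + κ * G i) ⟩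
      0ℚ                                                      ∎
    H-half : ∀ i → H (i ℤ.+ + h) ≡ - (κ * shiftSum a G i + G i)
    H-half i = begin
      - (shiftSum a G (i ℤ.+ + h) + κ * G (i ℤ.+ + h))
        ≡⟨ cong₂ (λ x y → - (x + κ * y)) (shiftSum-half-eigen κ G eigen a i) (eigen i) ⟩
      - (κ * shiftSum a G i + κ * (κ * G i))
        ≡⟨ cong (λ t → - (κ * shiftSum a G i + t)) (trans (sym (ℚ.*-assoc κ κ (G i)))
             (trans (cong (_* G i) κ²≡1) (ℚ.*-identityˡ (G i)))) ⟩
      - (κ * shiftSum a G i + G i) ∎
    y-equation : ∀ i → adjSum b H G i ≡ 0ℚ
    y-equation i = begin
      shiftSum b H i + H (i ℤ.+ + h) + G i
        ≡⟨ cong (λ t → shiftSum b H i + t + G i) (H-half i) ⟩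
      shiftSum b H i + - (κ * shiftSum a G i + G i) + G i
        ≡⟨ solve 7 (λ k x₁ x₂ g₁ g₂ S g →
             :- (x₁ :+ k :* g₁) :+ :- (x₂ :+ k :* g₂) :+ :- (k :* S :+ g) :+ g
               := :- ((x₁ :+ x₂) :+ k :* (S :+ (g₁ :+ g₂))))
             refl κ (shiftSum a G (i ℤ.+ + b)) (shiftSum a G (i ℤ.- + b)) (G (i ℤ.+ + b)) (G (i ℤ.- + b))
             (shiftSum a G i) (G i) ⟩
      - (shiftSum b (shiftSum a G) i + κ * (shiftSum a G i + shiftSum b G i))
        ≡⟨ cong -_ (balance i) ⟩
      0ℚ ∎
      where open ℚ-Solver

  alternating-solution : ∀ {F} → 2 ∣ a → 2 ∣ b → ¬ 2 ∣ h → (∀ i → F (i ℤ.+ + h) ≡ F i) → Balanced a b F →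
    IsSolution (λ i → alternating i * F i) (companion (- 1ℚ) (λ i → alternating i * F i))
  alternating-solution {F} 2∣a 2∣b 2∤h F-half balanced = eigen-solution (- 1ℚ) G eigen refl balance
    where
    G : ℤ → ℚ
    G i = alternating i * F i
    eigen : ∀ i → G (i ℤ.+ + h) ≡ - 1ℚ * G i
    eigen i = trans (cong₂ _*_ (alternating-odd-shift 2∤h i) (F-half i))
      (solve 2 (λ x y → (:- x) :* y := con (- 1ℚ) :* (x :* y)) refl (alternating i) (F i))
      where open ℚ-Solver
    twist : ∀ {s} → 2 ∣ s → ∀ F′ i → shiftSum s (λ j → alternating j * F′ j) i ≡ alternating i * shiftSum s F′ i
    twist {s} 2∣s F′ i = trans
      (cong₂ _+_ (cong (_* F′ (i ℤ.+ + s)) (alternating-even-shift 2∣s i))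
                 (cong (_* F′ (i ℤ.- + s)) (alternating-even-shift⁻ 2∣s i)))
      (sym (ℚ.*-distribˡ-+ (alternating i) (F′ (i ℤ.+ + s)) (F′ (i ℤ.- + s))))
    balance : ∀ i → shiftSum b (shiftSum a G) i + - 1ℚ * (shiftSum a G i + shiftSum b G i) ≡ 0ℚ
    balance i = begin
      shiftSum b (shiftSum a G) i + - 1ℚ * (shiftSum a G i + shiftSum b G i)
        ≡⟨ cong₂ (λ x y → x + - 1ℚ * y) (trans (shiftSum-cong b (twist 2∣a F) i) (twist 2∣b (shiftSum a F) i))
                                         (cong₂ _+_ (twist 2∣a F i) (twist 2∣b F i)) ⟩
      σ * shiftSum b (shiftSum a F) i + - 1ℚ * (σ * shiftSum a F i + σ * shiftSum b F i)
        ≡⟨ cong (λ t → σ * t + - 1ℚ * (σ * shiftSum a F i + σ * shiftSum b F i)) (balanced i) ⟩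
      σ * (shiftSum a F i + shiftSum b F i) + - 1ℚ * (σ * shiftSum a F i + σ * shiftSum b F i)
        ≡⟨ solve 3 (λ σ x y → σ :* (x :+ y) :+ con (- 1ℚ) :* (σ :* x :+ σ :* y) := con 0ℚ) refl
             σ (shiftSum a F i) (shiftSum b F i) ⟩
      0ℚ ∎
      where
      open ℚ-Solver
      σ = alternating i

module B₁-Kernel (m a b : ℕ) {{_ : NonZero m}} (m≡h+h : m ≡ m ℕ./ 2 ℕ.+ m ℕ./ 2)
                 (0<a : 0 ℕ.< a) (a<h : a ℕ.< m ℕ./ 2) (0<b : 0 ℕ.< b) (b<h : b ℕ.< m ℕ./ 2) where
  open FiniteSums
  open Congruences
  open ShiftSums
  open Equations (m ℕ./ 2) a b
  open Signs
    using (_^_; p*q≡0⇒q≡0; p≡d*p⇒d≡1; linked-product; geometric-parity; IsSign⇒square≡1; IsSign-^; odd≡1+2q)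
  open PeriodicFunctions
  open import Data.Nat.Divisibility using (_∣_; _∣?_; divides; ∣-trans)
  open import Data.Nat.GCD using (gcd; gcd[m,n]∣m; gcd[m,n]∣n; gcd[m,n]≡0⇒m≡0)
  open import Data.Nat.Coprimality using (coprime-divisor; gcd≡1⇒coprime)
  open import Relation.Nullary.Decidable using (decidable-stable; _⊎-dec_)
  import Data.Nat.Solver
  open import Data.Integer as ℤ using (ℤ; +_; 0ℤ; 1ℤ)
  open import Data.Nat.DivMod using (_%_; [m+kn]%n≡m%n)
  import Data.Nat.Properties as ℕ
  open import Data.Rational using (ℚ; 0ℚ; 1ℚ; _+_; _*_; -_)
  import Data.Rational.Properties as ℚ
  open import Function.Properties.Equivalence using () renaming (trans to ⇔-trans; sym to ⇔-sym)
  open ≡-Reasoning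

  h : ℕ
  h = m ℕ./ 2

  residue-apart : ∀ i {j} n → 0 ℕ.< n → n ℕ.< m → j ≡ i ℤ.+ + n → residue m i ≢ residue m j
  residue-apart i n 0<n n<m refl i↦j =
    +-≢-mod i 0<n n<m (≡-mod-sym (residue-injective i↦j))

  module _ (s : ℕ) (0<s : 0 ℕ.< s) (s<h : s ℕ.< h) where

    private
      s≤h : s ℕ.≤ h
      s≤h = ℕ.<⇒≤ s<h
      h<m : h ℕ.< m
      h<m = subst (h ℕ.<_) (sym m≡h+h) (ℕ.m<m+n h (ℕ.<-trans 0<s s<h))
      +m : ∀ {n} → n ℕ.< h ℕ.+ h → n ℕ.< m
      +m = subst (_ ℕ.<_) (sym m≡h+h)

    cycAdj-row : ∀ (f : Fin m → ℚ) i →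
      Σ[< m ] (λ j → adjEntry (cycAdj m s (toℕ i) (toℕ j)) * f j)
        ≡ f (residue m (+ toℕ i ℤ.+ + s)) + (f (residue m (+ toℕ i ℤ.- + s)) + f (residue m (+ toℕ i ℤ.+ + h)))
    cycAdj-row f i = Σ-indicator₃ m _ _ _ _ _ _ f
      (residue-spec (ι ℤ.+ + s)) backward (residue-spec (ι ℤ.+ + h))
      (residue-apart (ι ℤ.- + s) (s ℕ.+ s) (ℕ.<-≤-trans 0<s (ℕ.m≤m+n s s)) (+m (ℕ.+-mono-< s<h s<h))
        (solve 2 (λ i s → i :+ s := i :- s :+ (s :+ s)) refl ι (+ s)) ∘ sym)
      (residue-apart (ι ℤ.+ + s) (h ℕ.∸ s) (ℕ.m<n⇒0<n∸m s<h) (ℕ.≤-<-trans (ℕ.m∸n≤m h s) h<m) +s+[h-s]≡+h)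
      (residue-apart (ι ℤ.- + s) (h ℕ.+ s) (ℕ.<-≤-trans 0<s (ℕ.m≤n+m s h)) (+m (ℕ.+-monoʳ-< h s<h))
        (solve 3 (λ i s h → i :+ h := i :- s :+ (h :+ s)) refl ι (+ s) (+ h)))
      where
      open ℤ-Solver
      ι = + toℕ i
      backward : ∀ j → T ((toℕ j ℕ.+ s) % m ℕ.≡ᵇ toℕ i) ⇔ residue m (ι ℤ.- + s) ≡ j
      backward j = ⇔-trans (residue-spec (+ toℕ j ℤ.+ + s) i)
        (⇔-trans residue≡⇔ (⇔-trans (≡-mod-transpose {c = + s}) (⇔-sym residue≡⇔)))
      +s+[h-s]≡+h : ι ℤ.+ + h ≡ ι ℤ.+ + s ℤ.+ + (h ℕ.∸ s)
      +s+[h-s]≡+h = trans (cong (λ n → ι ℤ.+ + n) (sym (ℕ.m+[n∸m]≡n s≤h)))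
        (solve 3 (λ i s t → i :+ (s :+ t) := i :+ s :+ t) refl ι (+ s) (+ (h ℕ.∸ s)))

  Vector : Set
  Vector = Fin (m ℕ.+ m) → ℚ

  xPart yPart : Vector → ℤ → ℚ
  xPart x i = x (residue m i ↑ˡ m)
  yPart x i = x (m ↑ʳ residue m i)

  xPart-periodic : ∀ x → Periodic m (xPart x)
  xPart-periodic x = cong (λ r → x (r ↑ˡ m)) ∘ residue-cong

  yPart-periodic : ∀ x → Periodic m (yPart x)
  yPart-periodic x = cong (λ r → x (m ↑ʳ r)) ∘ residue-cong

  glue : (ℤ → ℚ) → (ℤ → ℚ) → Vector
  glue F G v = [ (λ i → F (+ toℕ i)) , (λ i → G (+ toℕ i)) ]′ (Fin.splitAt m v)

  xPart-glue : ∀ {F} G → Periodic m F → ∀ i → xPart (glue F G) i ≡ F i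
  xPart-glue {F} G F-periodic i rewrite FinP.splitAt-↑ˡ m (residue m i) m =
    F-periodic (≡-mod-sym (≡-mod-residue i))

  yPart-glue : ∀ F {G} → Periodic m G → ∀ i → yPart (glue F G) i ≡ G i
  yPart-glue F {G} G-periodic i rewrite FinP.splitAt-↑ʳ m m (residue m i) =
    G-periodic (≡-mod-sym (≡-mod-residue i))

  B₁-xx : ∀ i j → B₁ m a b (i ↑ˡ m) (j ↑ˡ m) ≡ cycAdj m a (toℕ i) (toℕ j)
  B₁-xx i j rewrite FinP.splitAt-↑ˡ m i m | FinP.splitAt-↑ˡ m j m = refl

  B₁-xy : ∀ i j → B₁ m a b (i ↑ˡ m) (m ↑ʳ j) ≡ (toℕ i ℕ.≡ᵇ toℕ j)
  B₁-xy i j rewrite FinP.splitAt-↑ˡ m i m | FinP.splitAt-↑ʳ m m j = refl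

  B₁-yx : ∀ i j → B₁ m a b (m ↑ʳ i) (j ↑ˡ m) ≡ (toℕ i ℕ.≡ᵇ toℕ j)
  B₁-yx i j rewrite FinP.splitAt-↑ʳ m m i | FinP.splitAt-↑ˡ m j m = refl

  B₁-yy : ∀ i j → B₁ m a b (m ↑ʳ i) (m ↑ʳ j) ≡ cycAdj m b (toℕ i) (toℕ j)
  B₁-yy i j rewrite FinP.splitAt-↑ʳ m m i | FinP.splitAt-↑ʳ m m j = refl

  matching-row : ∀ (f : Fin m → ℚ) i → Σ[< m ] (λ j → adjEntry (toℕ i ℕ.≡ᵇ toℕ j) * f j) ≡ f (residue m (+ toℕ i))
  matching-row f i = Σ-indicator m _ _ f (λ j → mk⇔
    (λ i≡j → trans (residue-toℕ i) (FinP.toℕ-injective (ℕ.≡ᵇ⇒≡ (toℕ i) (toℕ j) i≡j)))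
    (λ i↦j → ℕ.≡⇒≡ᵇ (toℕ i) (toℕ j) (cong toℕ (trans (sym (residue-toℕ i)) i↦j))))

  x-row : ∀ x i → Σ[< m ℕ.+ m ] (λ v → adjEntry (B₁ m a b (i ↑ˡ m) v) * x v) ≡ adjSum a (xPart x) (yPart x) (+ toℕ i)
  x-row x i = begin
    Σ[< m ℕ.+ m ] (λ v → adjEntry (B₁ m a b (i ↑ˡ m) v) * x v)
      ≡⟨ Σ-++ m m _ ⟩
    Σ[< m ] (λ j → adjEntry (B₁ m a b (i ↑ˡ m) (j ↑ˡ m)) * x (j ↑ˡ m))
      + Σ[< m ] (λ j → adjEntry (B₁ m a b (i ↑ˡ m) (m ↑ʳ j)) * x (m ↑ʳ j))
      ≡⟨ cong₂ _+_ (Σ-cong m (λ j → cong (λ e → adjEntry e * x (j ↑ˡ m)) (B₁-xx i j)))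
                   (Σ-cong m (λ j → cong (λ e → adjEntry e * x (m ↑ʳ j)) (B₁-xy i j))) ⟩
    Σ[< m ] (λ j → adjEntry (cycAdj m a (toℕ i) (toℕ j)) * x (j ↑ˡ m))
      + Σ[< m ] (λ j → adjEntry (toℕ i ℕ.≡ᵇ toℕ j) * x (m ↑ʳ j))
      ≡⟨ cong₂ _+_ (cycAdj-row a 0<a a<h (λ j → x (j ↑ˡ m)) i) (matching-row (λ j → x (m ↑ʳ j)) i) ⟩
    X (ι ℤ.+ + a) + (X (ι ℤ.- + a) + X (ι ℤ.+ + h)) + Y ι
      ≡⟨ cong (_+ Y ι) (sym (ℚ.+-assoc (X (ι ℤ.+ + a)) (X (ι ℤ.- + a)) (X (ι ℤ.+ + h)))) ⟩
    adjSum a X Y ι ∎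
    where
    X = xPart x
    Y = yPart x
    ι = + toℕ i

  y-row : ∀ x i → Σ[< m ℕ.+ m ] (λ v → adjEntry (B₁ m a b (m ↑ʳ i) v) * x v) ≡ adjSum b (yPart x) (xPart x) (+ toℕ i)
  y-row x i = begin
    Σ[< m ℕ.+ m ] (λ v → adjEntry (B₁ m a b (m ↑ʳ i) v) * x v)
      ≡⟨ Σ-++ m m _ ⟩
    Σ[< m ] (λ j → adjEntry (B₁ m a b (m ↑ʳ i) (j ↑ˡ m)) * x (j ↑ˡ m))
      + Σ[< m ] (λ j → adjEntry (B₁ m a b (m ↑ʳ i) (m ↑ʳ j)) * x (m ↑ʳ j))
      ≡⟨ cong₂ _+_ (Σ-cong m (λ j → cong (λ e → adjEntry e * x (j ↑ˡ m)) (B₁-yx i j)))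
                   (Σ-cong m (λ j → cong (λ e → adjEntry e * x (m ↑ʳ j)) (B₁-yy i j))) ⟩
    Σ[< m ] (λ j → adjEntry (toℕ i ℕ.≡ᵇ toℕ j) * x (j ↑ˡ m))
      + Σ[< m ] (λ j → adjEntry (cycAdj m b (toℕ i) (toℕ j)) * x (m ↑ʳ j))
      ≡⟨ cong₂ _+_ (matching-row (λ j → x (j ↑ˡ m)) i) (cycAdj-row b 0<b b<h (λ j → x (m ↑ʳ j)) i) ⟩
    X ι + (Y (ι ℤ.+ + b) + (Y (ι ℤ.- + b) + Y (ι ℤ.+ + h)))
      ≡⟨ solve 4 (λ x y₁ y₂ y₃ → x :+ (y₁ :+ (y₂ :+ y₃)) := y₁ :+ y₂ :+ y₃ :+ x) refl
           (X ι) (Y (ι ℤ.+ + b)) (Y (ι ℤ.- + b)) (Y (ι ℤ.+ + h)) ⟩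
    adjSum b Y X ι ∎
    where
    open ℚ-Solver
    X = xPart x
    Y = yPart x
    ι = + toℕ i

  kernel⇒solution : ∀ x → InKernel (B₁ m a b) x → IsSolution (xPart x) (yPart x)
  kernel⇒solution x x-kernel =
      (λ i → begin
        adjSum a X Y i              ≡⟨ adjSum-periodic a (xPart-periodic x) (yPart-periodic x) (≡-mod-residue i) ⟩
        adjSum a X Y (ι (residue m i)) ≡⟨ x-row x (residue m i) ⟨
        _                           ≡⟨ x-kernel (residue m i ↑ˡ m) ⟩
        0ℚ                          ∎)
    , (λ i → begin
        adjSum b Y X i              ≡⟨ adjSum-periodic b (yPart-periodic x) (xPart-periodic x) (≡-mod-residue i) ⟩
        adjSum b Y X (ι (residue m i)) ≡⟨ y-row x (residue m i) ⟨
        _                           ≡⟨ x-kernel (m ↑ʳ residue m i) ⟩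
        0ℚ                          ∎)
    where
    X = xPart x
    Y = yPart x
    ι : Fin m → ℤ
    ι r = + toℕ r

  halves : ∀ (v : Fin (m ℕ.+ m)) → (∃[ i ] i ↑ˡ m ≡ v) ⊎ (∃[ i ] m ↑ʳ i ≡ v)
  halves v with Fin.splitAt m v in eq
  ... | inj₁ i = inj₁ (i , FinP.splitAt⁻¹-↑ˡ eq)
  ... | inj₂ i = inj₂ (i , FinP.splitAt⁻¹-↑ʳ eq)

  solution⇒kernel : ∀ {F G} → Periodic m F → Periodic m G → IsSolution F G → InKernel (B₁ m a b) (glue F G)
  solution⇒kernel {F} {G} F-periodic G-periodic (x-equation , y-equation) v with halves v
  ... | inj₁ (i , refl) = trans (x-row (glue F G) i)
      (trans (adjSum-cong a (xPart-glue G F-periodic) (yPart-glue F G-periodic) (+ toℕ i)) (x-equation (+ toℕ i)))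
  ... | inj₂ (i , refl) = trans (y-row (glue F G) i)
      (trans (adjSum-cong b (yPart-glue F G-periodic) (xPart-glue G F-periodic) (+ toℕ i)) (y-equation (+ toℕ i)))

  module NutVector (nut : IsNut (B₁ m a b)) where

    x : Vector
    x = proj₁ nut

    X Y : ℤ → ℚ
    X = xPart x
    Y = yPart x

    X-nonzero : ∀ i → X i ≢ 0ℚ
    X-nonzero i = proj₁ (proj₂ (proj₂ nut)) (residue m i ↑ˡ m)

    solution : IsSolution X Y
    solution = kernel⇒solution x (proj₁ (proj₂ nut))

    proportional : ∀ {F G} → Periodic m F → Periodic m G → IsSolution F G →
      ∃[ c ] (∀ i → F i ≡ c * X i) × (∀ i → G i ≡ c * Y i)
    proportional {F} {G} F-periodic G-periodic F,G-solution
      with proj₂ (proj₂ (proj₂ nut)) (glue F G) (solution⇒kernel F-periodic G-periodic F,G-solution)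
    ... | c , glue≡cx =
      c , (λ i → trans (sym (xPart-glue G F-periodic i)) (glue≡cx (residue m i ↑ˡ m)))
        , (λ i → trans (sym (yPart-glue F G-periodic i)) (glue≡cx (m ↑ʳ residue m i)))

    Reflective : ℤ → ℚ → Set
    Reflective k d = (∀ i → X (k ℤ.- i) ≡ d * X i) × (∀ i → Y (k ℤ.- i) ≡ d * Y i)

    reflection : ∀ k → ∃[ d ] Reflective k d
    reflection k = proportional (reflect-periodic (xPart-periodic x)) (reflect-periodic (yPart-periodic x))
      (reflect-solution (subst (λ n → Periodic n X) m≡h+h (xPart-periodic x))
                        (subst (λ n → Periodic n Y) m≡h+h (yPart-periodic x)) solution k)
      where
      reflect-periodic : ∀ {F : ℤ → ℚ} → Periodic m F → Periodic m (λ i → F (k ℤ.- i))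
      reflect-periodic F-periodic i≡j = F-periodic (minus-cong-mod (≡-mod-refl {i = k}) i≡j)

    Reflective-0⇒symmetric : ∀ {d} → Reflective 0ℤ d → Symmetric X × Symmetric Y
    Reflective-0⇒symmetric {d} (X-reflect , Y-reflect) =
      (λ i → trans (X-reflect i) (unit (X i))) , (λ i → trans (Y-reflect i) (unit (Y i)))
      where
      unit : ∀ q → d * q ≡ q
      unit q = trans (cong (_* q) (p≡d*p⇒d≡1 {d} (X-nonzero 0ℤ) (X-reflect 0ℤ))) (ℚ.*-identityˡ q)

    symmetric : Symmetric X × Symmetric Y
    symmetric = Reflective-0⇒symmetric {proj₁ (reflection 0ℤ)} (proj₂ (reflection 0ℤ))

    Reflective-1⇒ratio : ∀ {c} → Reflective 1ℤ c → c * c ≡ 1ℚ × HasRatio c X × HasRatio c Y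
    Reflective-1⇒ratio {c} (X-reflect , Y-reflect) = c²≡1 , X-step , step {Y} Y-reflect (proj₂ symmetric)
      where
      double-reflection : ∀ i → i ℤ.+ 1ℤ ≡ 1ℤ ℤ.- (0ℤ ℤ.- i)
      double-reflection = solve 1 (λ i → i :+ con 1ℤ := con 1ℤ :- (con 0ℤ :- i)) refl
        where open ℤ-Solver
      step : ∀ {F} → (∀ i → F (1ℤ ℤ.- i) ≡ c * F i) → Symmetric F → HasRatio c F
      step {F} F-reflect F-symmetric i = begin
        F (i ℤ.+ 1ℤ)               ≡⟨ cong F (double-reflection i) ⟩
        F (1ℤ ℤ.- (0ℤ ℤ.- i))      ≡⟨ F-reflect (0ℤ ℤ.- i) ⟩
        c * F (0ℤ ℤ.- i)           ≡⟨ cong (c *_) (F-symmetric i) ⟩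
        c * F i                    ∎
      X-step : HasRatio c X
      X-step = step {X} X-reflect (proj₁ symmetric)
      c²≡1 : c * c ≡ 1ℚ
      c²≡1 = p≡d*p⇒d≡1 {c * c} (X-nonzero 0ℤ) (begin
        X 0ℤ             ≡⟨ X-reflect 1ℤ ⟩
        c * X 1ℤ         ≡⟨ cong (c *_) (X-step 0ℤ) ⟩
        c * (c * X 0ℤ)   ≡⟨ ℚ.*-assoc c c (X 0ℤ) ⟨
        c * c * X 0ℤ     ∎)

    ratio : ℚ
    ratio = proj₁ (reflection 1ℤ)

    ratio-spec : ratio * ratio ≡ 1ℚ × HasRatio ratio X × HasRatio ratio Y
    ratio-spec = Reflective-1⇒ratio {ratio} (proj₂ (reflection 1ℤ))

  nut⇒parity : IsNut (B₁ m a b) → (2 ∣ a × 2 ∣ b × ¬ 2 ∣ h) ⊎ (¬ 2 ∣ a × ¬ 2 ∣ b × 2 ∣ h)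
  nut⇒parity nut = geometric-parity {ratio} a b h ratio²≡1
      (linked-product {ratio ^ a + ratio ^ a + ratio ^ h} {ratio ^ b + ratio ^ b + ratio ^ h} {X 0ℤ} {Y 0ℤ}
        (X-nonzero 0ℤ)
        (trans (sym (geometric-adjSum {G = Y} {ratio} a X-step (proj₁ symmetric))) (proj₁ solution 0ℤ))
        (trans (sym (geometric-adjSum {G = X} {ratio} b Y-step (proj₂ symmetric))) (proj₂ solution 0ℤ)))
    where
    open NutVector nut
    ratio²≡1 : ratio * ratio ≡ 1ℚ
    ratio²≡1 = proj₁ ratio-spec
    X-step : HasRatio ratio X
    X-step = proj₁ (proj₂ ratio-spec)
    Y-step : HasRatio ratio Y
    Y-step = proj₂ (proj₂ ratio-spec)

  ¬nut-of-vanishing-solution : ∀ κ {G} → Periodic m G → IsSolution G (companion κ G) →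
    G 1ℤ ≡ 0ℚ → G 0ℤ ≢ 0ℚ → ¬ IsNut (B₁ m a b)
  ¬nut-of-vanishing-solution κ {G} G-periodic G-solution G1≡0 G0≢0 nut =
    G0≢0 (trans (G≡cX 0ℤ) (trans (cong (_* X 0ℤ) c≡0) (ℚ.*-zeroˡ (X 0ℤ))))
    where
    open NutVector nut
    proportionality = proportional G-periodic (companion-periodic κ G-periodic) G-solution
    c = proj₁ proportionality
    G≡cX : ∀ i → G i ≡ c * X i
    G≡cX = proj₁ (proj₂ proportionality)
    c≡0 : c ≡ 0ℚ
    c≡0 = p*q≡0⇒q≡0 (X-nonzero 1ℤ) (trans (ℚ.*-comm (X 1ℤ) c) (trans (sym (G≡cX 1ℤ)) G1≡0))

  private
    m≡2h : m ≡ 2 ℕ.* h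
    m≡2h = trans m≡h+h (cong (h ℕ.+_) (sym (ℕ.+-identityʳ h)))

    h∣m : h ∣ m
    h∣m = divides 2 m≡2h

    2∣m : 2 ∣ m
    2∣m = divides h (trans m≡2h (ℕ.*-comm 2 h))

    h≡2q⇒4∣m : ∀ {q} → h ≡ q ℕ.* 2 → 4 ∣ m
    h≡2q⇒4∣m {q} h≡2q = divides q (begin
      m                   ≡⟨ m≡h+h ⟩
      h ℕ.+ h             ≡⟨ cong₂ ℕ._+_ h≡2q h≡2q ⟩
      q ℕ.* 2 ℕ.+ q ℕ.* 2 ≡⟨ ℕ.*-distribˡ-+ q 2 2 ⟨
      q ℕ.* 4             ∎)

  ¬nut-odd-shifts : ¬ 2 ∣ a → ¬ 2 ∣ b → 2 ∣ h → ¬ IsNut (B₁ m a b)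
  ¬nut-odd-shifts 2∤a 2∤b (divides q h≡2q) =
    ¬nut-of-vanishing-solution κ (periodic-weaken (h≡2q⇒4∣m {q} h≡2q) quarterWave-periodic)
      (eigen-solution κ quarterWave half-shift (IsSign⇒square≡1 (IsSign-^ (inj₂ refl) q)) balance) refl (λ ())
    where
    κ = (- 1ℚ) ^ q
    half-shift : ∀ i → quarterWave (i ℤ.+ + h) ≡ κ * quarterWave i
    half-shift i = trans (cong (λ n → quarterWave (i ℤ.+ + n)) h≡2q) (quarterWave-even-shift q i)
    balance : ∀ i →
      shiftSum b (shiftSum a quarterWave) i + κ * (shiftSum a quarterWave i + shiftSum b quarterWave i) ≡ 0ℚ
    balance i = begin
      shiftSum b (shiftSum a quarterWave) i + κ * (shiftSum a quarterWave i + shiftSum b quarterWave i)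
        ≡⟨ cong₂ (λ x y → x + κ * y) (shiftSum-cong b (quarterWave-odd-shiftSum 2∤a) i)
             (cong₂ _+_ (quarterWave-odd-shiftSum 2∤a i) (quarterWave-odd-shiftSum 2∤b i)) ⟩
      0ℚ + κ * 0ℚ ≡⟨ cong (λ t → 0ℚ + t) (ℚ.*-zeroʳ κ) ⟩
      0ℚ ∎

  ¬nut-alternating : 2 ∣ a → 2 ∣ b → ¬ 2 ∣ h → ∀ {d} {{_ : NonZero d}} → d ∣ h → 1 ℕ.< d →
    Balanced a b (divisibleBy d) → ¬ IsNut (B₁ m a b)
  ¬nut-alternating 2∣a 2∣b 2∤h {d} d∣h 1<d balanced =
    ¬nut-of-vanishing-solution (- 1ℚ) G-periodic
      (alternating-solution 2∣a 2∣b 2∤h (λ i → divisibleBy-periodic (+multiple-≡-mod i d∣h)) balanced)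
      (trans (cong (alternating 1ℤ *_) (divisibleBy-1 1<d)) (ℚ.*-zeroʳ (alternating 1ℤ)))
      (λ G0≡0 → 1≢0 (trans (sym (cong (alternating 0ℤ *_) divisibleBy-0)) G0≡0))
    where
    G-periodic : Periodic m (λ i → alternating i * divisibleBy d i)
    G-periodic i≡j = cong₂ _*_ (periodic-weaken 2∣m alternating-periodic i≡j)
                                (periodic-weaken (∣-trans d∣h h∣m) divisibleBy-periodic i≡j)
    1≢0 : 1ℚ ≢ 0ℚ
    1≢0 ()

  ¬nut-common-divisor : 2 ∣ a → 2 ∣ b → ¬ 2 ∣ h → gcd (gcd h a) b ≢ 1 → ¬ IsNut (B₁ m a b)
  ¬nut-common-divisor 2∣a 2∣b 2∤h d≢1 =
    ¬nut-alternating 2∣a 2∣b 2∤h d∣h 1<d (balanced-of-periodic divisibleBy-periodic d∣a d∣b)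
    where
    d = gcd (gcd h a) b
    d≢0 : d ≢ 0
    d≢0 = ℕ.<⇒≢ (ℕ.<-trans 0<a a<h) ∘ sym ∘ gcd[m,n]≡0⇒m≡0 ∘ gcd[m,n]≡0⇒m≡0
    instance
      d-nonzero : NonZero d
      d-nonzero = ℕ.≢-nonZero d≢0
    1<d : 1 ℕ.< d
    1<d = ℕ.≤∧≢⇒< (ℕ.>-nonZero⁻¹ d) (d≢1 ∘ sym)
    d∣h : d ∣ h
    d∣h = ∣-trans (gcd[m,n]∣m (gcd h a) b) (gcd[m,n]∣m h a)
    d∣a : d ∣ a
    d∣a = ∣-trans (gcd[m,n]∣m (gcd h a) b) (gcd[m,n]∣n h a)
    d∣b : d ∣ b
    d∣b = gcd[m,n]∣n (gcd h a) b

  ¬nut-mod-5 : 2 ∣ a → 2 ∣ b → ¬ 2 ∣ h → 5 ∣ m → Nondegenerate5 (+ a) (+ b) → ¬ IsNut (B₁ m a b)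
  ¬nut-mod-5 2∣a 2∣b 2∤h 5∣m nondegenerate =
    ¬nut-alternating 2∣a 2∣b 2∤h 5∣h (ℕ.s≤s (ℕ.s≤s ℕ.z≤n)) (divisibleBy5-balanced nondegenerate)
    where
    5∣h : 5 ∣ h
    5∣h = coprime-divisor {5} {2} (gcd≡1⇒coprime refl) (subst (5 ∣_) m≡2h 5∣m)

  m%4≡2 : ¬ 2 ∣ h → m % 4 ≡ 2
  m%4≡2 2∤h = begin
    m % 4                             ≡⟨ cong (_% 4) (trans m≡h+h (cong₂ ℕ._+_ h≡1+2q h≡1+2q)) ⟩
    (suc (q ℕ.* 2) ℕ.+ suc (q ℕ.* 2)) % 4
      ≡⟨ cong (_% 4) (solve 1 (λ q → (con 1 :+ q :* con 2) :+ (con 1 :+ q :* con 2) := con 2 :+ q :* con 4) refl q) ⟩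
    (2 ℕ.+ q ℕ.* 4) % 4               ≡⟨ [m+kn]%n≡m%n 2 q 4 ⟩
    2                                 ∎
    where
    open Data.Nat.Solver.+-*-Solver
    q = h ℕ./ 2
    h≡1+2q : h ≡ suc (q ℕ.* 2)
    h≡1+2q = odd≡1+2q 2∤h

  Conditions : Set
  Conditions = (m % 4 ≡ 2) × (2 ∣ a × 2 ∣ b) × (gcd (gcd h a) b ≡ 1)
             × (5 ∣ m → 5 ∣ a ⊎ 5 ∣ b ⊎ 5 ∣ (b ℕ.∸ a) ⊎ 5 ∣ (a ℕ.+ b))

  nut-conditions : a ℕ.≤ b → IsNut (B₁ m a b) → Conditions
  nut-conditions a≤b nut =
    [ even-shifts , (λ (2∤a , 2∤b , 2∣h) → ⊥-elim (¬nut-odd-shifts 2∤a 2∤b 2∣h nut)) ]′ (nut⇒parity nut)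
    where
    even-shifts : 2 ∣ a × 2 ∣ b × ¬ 2 ∣ h → Conditions
    even-shifts (2∣a , 2∣b , 2∤h) = m%4≡2 2∤h , (2∣a , 2∣b) , coprime , five
      where
      coprime : gcd (gcd h a) b ≡ 1
      coprime = decidable-stable (gcd (gcd h a) b ℕ.≟ 1) (λ d≢1 → ¬nut-common-divisor 2∣a 2∣b 2∤h d≢1 nut)
      five : 5 ∣ m → 5 ∣ a ⊎ 5 ∣ b ⊎ 5 ∣ (b ℕ.∸ a) ⊎ 5 ∣ (a ℕ.+ b)
      five 5∣m = decidable-stable (5 ∣? a ⊎-dec 5 ∣? b ⊎-dec 5 ∣? (b ℕ.∸ a) ⊎-dec 5 ∣? (a ℕ.+ b))
        (λ none → ¬nut-mod-5 2∣a 2∣b 2∤h 5∣m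
          (nondegenerate5 a≤b (none ∘ inj₁) (none ∘ inj₂ ∘ inj₁)
                              (none ∘ inj₂ ∘ inj₂ ∘ inj₁) (none ∘ inj₂ ∘ inj₂ ∘ inj₂))
          nut)

open import Data.Nat using (_≤_; _<_; _+_; _∸_)
open import Data.Nat.DivMod using (_%_; _/_; m/n*n≡m)
open import Data.Nat.Divisibility using (_∣_)
open import Data.Nat.GCD using (gcd)
open import Data.Nat.Properties using (*-comm; +-identityʳ; ≤-<-trans; ≤-trans)

half-sum : ∀ {m} → 2 ∣ m → m ≡ m / 2 + m / 2
half-sum {m} 2∣m = begin
  m                     ≡⟨ m/n*n≡m 2∣m ⟨
  m / 2 ℕ.* 2           ≡⟨ *-comm (m / 2) 2 ⟩
  m / 2 + (m / 2 + 0)   ≡⟨ cong (m / 2 +_) (+-identityʳ (m / 2)) ⟩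
  m / 2 + m / 2         ∎
  where open ≡-Reasoning

lemma3p3 : (m a b : ℕ) {{_ : NonZero m}} → 4 ≤ m → 2 ∣ m → 1 ≤ a → a ≤ b → b < m / 2 →
    ¬ ((m % 4 ≡ 2)
       × (2 ∣ a × 2 ∣ b)
       × (gcd (gcd (m / 2) a) b ≡ 1)
       × (5 ∣ m → 5 ∣ a ⊎ 5 ∣ b ⊎ 5 ∣ (b ∸ a) ⊎ 5 ∣ (a + b))) →
    ¬ IsNut (B₁ m a b)
-- The hypothesis 4 ≤ m follows from 1 ≤ a < m / 2.
lemma3p3 m a b _ 2∣m 1≤a a≤b b<h conditions-fail nut = conditions-fail (nut-conditions a≤b nut)
  where open B₁-Kernel m a b (half-sum 2∣m) 1≤a (≤-<-trans a≤b b<h) (≤-trans 1≤a a≤b) b<h
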